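{- Let $\mathbb{K}$ be a field of characteristic $0$, $\ell\ge 2$, and let $N=(N_2,\ldots,N_\ell)$ be finite subsets of $\mathbb{K}$ with $N_2\subseteq N_3\subseteq\cdots\subseteq N_\ell$. Let $\mathcal{I}_N$ be the central arrangement in $\mathbb{K}^{\ell+1}$ (coordinates $x_1,\ldots,x_\ell,z$) with defining polynomial $Q(\mathcal{I}_N)= z\big(\prod_{j=2}^{\ell}\prod_{a\in N_j}(x_1-x_j-az)\big)\big(\prod_{2\le i<j\le \ell}(x_i-x_j)\big)$. Define \[\theta_0=\sum_{i=1}^{\ell}\frac{\partial}{\partial x_i},\qquad \theta_1=\sum_{i=1}^{\ell}x_i\frac{\partial}{\partial x_i}+z\frac{\partial}{\partial z},\] \[\theta_k=\sum_{s=2}^{k}\Big(\prod_{a\in N_k}(x_1-x_s-az)\prod_{t=k+1}^{\ell}(x_s-x_t)\Big)\frac{\partial}{\partial x_s}\quad(2\le k\le\ell).\] Then $\theta_0,\theta_1,\ldots,\theta_\ell$ form a basis of the $S$-module $D(\mathcal{I}_N)$. In particular $\mathcal{I}_N$ is free with exponents \[\exp\mathcal{I}_N=(0,\,1,\,|N_2|+\ell-2,\,|N_3|+\ell-3,\,\ldots,\,|N_\ell|).\]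
   Context: $S=\mathbb{K}[x_1,\ldots,x_\ell,z]$. For a central arrangement $\mathcal{A}$, $D(\mathcal{A})=\{\theta\in\mathrm{Der}_{\mathbb{K}}(S)\mid\theta(\alpha_H)\in\alpha_H S\text{ for all }H\in\mathcal{A}\}$, with $\alpha_H$ a linear form defining $H$. $\mathcal{A}$ is free if $D(\mathcal{A})$ is a free $S$-module; its exponents are the degrees of a homogeneous basis. $|N_j|$ is the cardinality of $N_j$. -}

module Defs where

open import Level using (Level; _⊔_) renaming (suc to lsuc)
open import Algebra.Bundles using (CommutativeRing)
open import Data.Nat using (ℕ; zero; suc; _∸_; _≡ᵇ_; _≤ᵇ_) renaming (_+_ to _+ℕ_)
open import Data.Nat.Properties using () renaming (_≟_ to _≟ℕ_)
open import Data.Bool using (Bool; true; false; if_then_else_; _∧_)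
open import Data.Fin using (Fin; toℕ)
open import Data.Vec using (Vec; tabulate; zipWith; replicate) renaming (sum to vsum)
open import Data.Vec.Properties using (≡-dec)
open import Data.List using (List; []; _∷_; _++_; map; concatMap; foldr; upTo; length)
open import Data.List.Relation.Unary.All using (All)
open import Data.List.Relation.Unary.Any using (Any)
open import Data.List.Relation.Unary.AllPairs using (AllPairs)
open import Data.Product using (Σ; ∃; _×_; _,_)
open import Relation.Nullary using (¬_; yes; no)
open import Relation.Binary.PropositionalEquality using (_≡_)

record Field (c r : Level) : Set (lsuc (c ⊔ r)) where
  field
    commutativeRing : CommutativeRing c r
  open CommutativeRing commutativeRing public
  field
    1≉0     : ¬ (1# ≈ 0#)
    inverse : ∀ x → ¬ (x ≈ 0#) → ∃ λ y → x * y ≈ 1#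

module _ {c r} (F : Field c r) where
  open Field F
  ℕ→K : ℕ → Carrier
  ℕ→K zero    = 0#
  ℕ→K (suc n) = 1# + ℕ→K n

CharZero : ∀ {c r} → Field c r → Set r
CharZero F = ∀ n → ¬ (Field._≈_ F (ℕ→K F (suc n)) (Field.0# F))

-- integer range [a, b] (empty if b < a)
[_⋯_] : ℕ → ℕ → List ℕ
[ a ⋯ b ] = map (a +ℕ_) (upTo (suc b ∸ a))

-- The polynomial ring S = K[z, x₁, …, x_ℓ], derivations, and the
-- arrangement 𝓘_N.  Variable index 0 is z, index i (1 ≤ i ≤ ℓ) is x_i.

module Arr {c r} (F : Field c r) (ℓ : ℕ) (N : ℕ → List (Field.Carrier F)) where
  open Field F

  Mono : Set
  Mono = Vec ℕ (suc ℓ)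

  Poly : Set c
  Poly = List (Carrier × Mono)

  coeff : Poly → Mono → Carrier
  coeff []              m = 0#
  coeff ((a , e) ∷ p) m with ≡-dec _≟ℕ_ e m
  ... | yes _ = a + coeff p m
  ... | no  _ = coeff p m

  infix 4 _≈P_
  _≈P_ : Poly → Poly → Set r
  p ≈P q = ∀ m → coeff p m ≈ coeff q m

  0P : Poly
  0P = []

  constP : Carrier → Poly
  constP a = (a , replicate _ 0) ∷ []

  1P : Poly
  1P = constP 1#

  infixl 6 _+P_ _-P_
  infixl 7 _*P_
  _+P_ : Poly → Poly → Poly
  p +P q = p ++ q

  -P_ : Poly → Poly
  -P p = map (λ { (a , e) → (- a , e) }) p

  _-P_ : Poly → Poly → Poly
  p -P q = p +P (-P q)

  _*P_ : Poly → Poly → Poly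
  p *P q = concatMap (λ { (a , e) → map (λ { (b , f) → (a * b , zipWith _+ℕ_ e f) }) q }) p

  -- the variable with index i (0 = z, i = x_i); only used for i ≤ ℓ
  X : ℕ → Poly
  X i = (1# , tabulate (λ j → if toℕ j ≡ᵇ i then 1 else 0)) ∷ []

  z : Poly
  z = X 0

  x : ℕ → Poly
  x i = X i

  ΣF : ∀ {n} → (Fin n → Poly) → Poly
  ΣF {zero}  f = 0P
  ΣF {suc n} f = f Fin.zero +P ΣF (λ k → f (Fin.suc k))

  ΠL : List Poly → Poly
  ΠL = foldr _*P_ 1P

  _∣P_ : Poly → Poly → Set (c ⊔ r)
  a ∣P b = ∃ λ g → b ≈P a *P g

  LinForm : Set c
  LinForm = Fin (suc ℓ) → Carrier

  L : LinForm → Poly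
  L α = ΣF (λ j → constP (α j) *P X (toℕ j))

  e : ℕ → LinForm
  e i j = if toℕ j ≡ᵇ i then 1# else 0#

  -- a derivation θ = Σ_j θ_j ∂/∂X_j, stored as its coefficient vector
  Der : Set c
  Der = Fin (suc ℓ) → Poly

  apply : Der → LinForm → Poly
  apply θ α = ΣF (λ j → constP (α j) *P θ j)

  -- D(𝓐) for an arrangement given by the list of its defining linear forms
  _∈D_ : Der → List LinForm → Set (c ⊔ r)
  θ ∈D 𝓐 = All (λ α → L α ∣P apply θ α) 𝓐

  hypA : ℕ → Carrier → LinForm
  hypA j a k = e 1 k - e j k - a * e 0 k

  hypB : ℕ → ℕ → LinForm
  hypB i j k = e i k - e j k

  𝓘N : List LinForm
  𝓘N = e 0
     ∷ (concatMap (λ j → map (hypA j) (N j)) [ 2 ⋯ ℓ ]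
        ++ concatMap (λ j → map (λ i → hypB i j) [ 2 ⋯ j ∸ 1 ]) [ 2 ⋯ ℓ ])

  θ : ℕ → Der
  θ zero          j = if toℕ j ≡ᵇ 0 then 0P else 1P
  θ (suc zero)    j = X (toℕ j)
  θ (suc (suc m)) j =
    if (2 ≤ᵇ s) ∧ (s ≤ᵇ k)
    then ΠL (map (λ a → x 1 -P x s -P constP a *P z) (N k))
         *P ΠL (map (λ t → x s -P x t) [ suc k ⋯ ℓ ])
    else 0P
    where
      k = suc (suc m)
      s = toℕ j

  comb : (Fin (suc ℓ) → Poly) → Der
  comb f i = ΣF (λ k → f k *P θ (toℕ k) i)

  IsBasisOfD : List LinForm → Set (c ⊔ r)
  IsBasisOfD 𝓐 =
      (∀ (k : Fin (suc ℓ)) → θ (toℕ k) ∈D 𝓐)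
    × (∀ (η : Der) → η ∈D 𝓐 → ∃ λ (f : Fin (suc ℓ) → Poly) → ∀ i → η i ≈P comb f i)
    × (∀ (f : Fin (suc ℓ) → Poly) → (∀ i → comb f i ≈P 0P) → ∀ k → f k ≈P 0P)

  HomPoly : ℕ → Poly → Set r
  HomPoly d p = ∀ m → ¬ (coeff p m ≈ 0#) → vsum m ≡ d

  HomDer : ℕ → Der → Set r
  HomDer d η = (∀ i → HomPoly d (η i)) × ¬ (∀ i → η i ≈P 0P)

  expo : ℕ → ℕ
  expo zero          = 0
  expo (suc zero)    = 1
  expo (suc (suc m)) = length (N (suc (suc m))) +ℕ ℓ ∸ suc (suc m)

  Conclusion : Set (c ⊔ r)
  Conclusion = IsBasisOfD 𝓘N × (∀ (k : Fin (suc ℓ)) → HomDer (expo (toℕ k)) (θ (toℕ k)))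

-- hypotheses on N = (N₂, …, N_ℓ): each N_j is a finite set (a duplicate-free
-- list), and N₂ ⊆ N₃ ⊆ ⋯ ⊆ N_ℓ
module _ {c r} (F : Field c r) where
  open Field F
  _∈K_ : Carrier → List Carrier → Set (c ⊔ r)
  a ∈K xs = Any (a ≈_) xs

  FiniteSets : ℕ → (ℕ → List Carrier) → Set (c ⊔ r)
  FiniteSets ℓ N = ∀ j → 2 Data.Nat.≤ j → j Data.Nat.≤ ℓ → AllPairs (λ a b → ¬ (a ≈ b)) (N j)

  Nested : ℕ → (ℕ → List Carrier) → Set (c ⊔ r)
  Nested ℓ N = ∀ j → 2 Data.Nat.≤ j → j Data.Nat.< ℓ → ∀ a → a ∈K N j → a ∈K N (suc j)

-- For k ≥ 2 the coefficient of ∂/∂x_s in θ_k (s ≤ k) is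
-- the product of the forms x₁ - x_s - a z (a ∈ N_k) and x_s - x_t (t > k): since N_j ⊆ N_k, it
-- vanishes on x₁ - x_j - a z for a ∈ N_j, and its values at s = i and s = j agree modulo x_i - x_j.
--
-- The coefficient matrix is triangular: θ_k has no x_j-component for j > k, and its x_k-component
-- is a product of linear forms, hence not a zero divisor. This gives independence.
--
-- For generation, subtract multiples of θ₀ and θ₁ from η ∈ D to clear its z- and x₁-components,
-- then clear the x_k-components for k = ℓ, ℓ-1, …, 2. When all components above x_k vanish, the
-- conditions at x₁ - x_k - a z and x_k - x_t (t > k) say that each of these pairwise coprime forms
-- divides the x_k-component, hence so does their product, the x_k-component of θ_k. Coprimality
-- and cancellation of linear forms x_v - β (β free of x_v) come from division with remainder.

module Submission where

open import Defs
open import Level using (_⊔_)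
open import Algebra.Bundles using (CommutativeRing; RawRing)
open import Algebra.Structures using (IsCommutativeRing)
open import Data.Nat as ℕ using (ℕ; zero; suc; _≤_; _<_; z≤n; s≤s; _≡ᵇ_; _≤ᵇ_)
import Data.Nat.Properties as ℕ
open import Data.Product using (Σ; ∃; _×_; _,_; proj₁; proj₂)
open import Data.Sum using (_⊎_; inj₁; inj₂)
open import Data.List as List using (List; []; _∷_; _++_; map)
import Data.List.Properties as List
open import Data.Maybe using (Maybe; just; nothing)
open import Data.Vec as Vec using (Vec; zipWith; replicate; tabulate)
import Data.Vec.Properties as Vec
open import Data.Empty using (⊥-elim)
open import Relation.Nullary using (¬_; Dec; yes; no)
open import Data.Bool using (Bool; true; false; if_then_else_; _∧_; T)
open import Data.Fin as Fin using (Fin; toℕ)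
import Data.Fin.Properties as Fin
open import Data.List.Relation.Unary.All as All using (All; []; _∷_)
import Data.List.Relation.Unary.All.Properties as All
open import Data.List.Relation.Unary.AllPairs using (AllPairs; []; _∷_)
open import Function using (_∘_)
open import Function.Bundles using (Equivalence)
import Data.Bool.Properties as Bool
open import Data.List.Membership.Propositional using (_∈_; find)
open import Data.List.Relation.Unary.Any as Any using (here; there)
import Data.List.Membership.Propositional.Properties as List
import Data.List.Relation.Unary.AllPairs as AllPairs
import Data.List.Relation.Unary.AllPairs.Properties as AllPairs
import Relation.Binary.Reasoning.Setoid
open import Relation.Binary using (tri<; tri≈; tri>)
import Relation.Binary.PropositionalEquality as ≡
open ≡ using (_≡_; _≢_)

module Ranges where

  ∈-⋯⁻ : ∀ {a b x} → x ∈ [ a ⋯ b ] → a ≤ x × x ≤ b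
  ∈-⋯⁻ {a} {b} x∈ with List.∈-map⁻ (a ℕ.+_) x∈
  ... | y , y∈ , ≡.refl = ℕ.m≤m+n a y , bounded (List.∈-upTo⁻ y∈)
    where
    bounded : y < suc b ℕ.∸ a → a ℕ.+ y ≤ b
    bounded lt = ≡.subst (_≤ b) (ℕ.+-comm y a) (ℕ.≤-pred (ℕ.m≤o∸n⇒m+n≤o (suc y) a≤1+b lt))
      where
      a≤1+b : a ≤ suc b
      a≤1+b = ℕ.<⇒≤ (ℕ.m∸n≢0⇒n<m (λ eq → ℕ.<⇒≱ lt (≡.subst (_≤ y) (≡.sym eq) z≤n)))

  ∈-⋯⁺ : ∀ {a b x} → a ≤ x → x ≤ b → x ∈ [ a ⋯ b ]
  ∈-⋯⁺ {a} {b} a≤x x≤b = ≡.subst (_∈ [ a ⋯ b ]) (ℕ.m+[n∸m]≡n a≤x)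
    (List.∈-map⁺ (a ℕ.+_) (List.∈-upTo⁺ (ℕ.∸-monoˡ-< (s≤s x≤b) a≤x)))

  ⋯-distinct : ∀ a b → AllPairs _≢_ [ a ⋯ b ]
  ⋯-distinct a b = AllPairs.map⁺ (AllPairs.applyUpTo⁺₁ (λ i → i) (suc b ℕ.∸ a)
    (λ i<j _ eq → ℕ.<⇒≢ i<j (ℕ.+-cancelˡ-≡ a _ _ eq)))

  length-⋯ : ∀ a b → List.length [ a ⋯ b ] ≡ suc b ℕ.∸ a
  length-⋯ a b = ≡.trans (List.length-map (a ℕ.+_) (List.upTo (suc b ℕ.∸ a)))
                         (List.length-applyUpTo (λ i → i) (suc b ℕ.∸ a))

module FormalDifferenceSolver {c r} (R : CommutativeRing c r) where
  open CommutativeRing R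
  open import Algebra.Solver.Ring.AlmostCommutativeRing
  open import Algebra.Properties.Ring ring
    using (-‿distribˡ-*; -‿distribʳ-*; -‿involutive; -‿+-comm; -0#≈0#; ⁻¹-anti-homo‿-; x∙y⁻¹≈ε⇒x≈y)
  open import Algebra.Properties.CommutativeSemigroup +-commutativeSemigroup using (interchange)
  open import Algebra.Properties.Semiring.Mult semiring using (×-homo-+; ×1-homo-*) renaming (_×_ to _·_)
  open import Relation.Binary.Reasoning.Setoid setoid

  -- The ring solver needs a coefficient ring mapping into R; the integers, encoded as formal
  -- differences (a , b) of naturals, map into every commutative ring.
  private
    ι : ℕ → Carrier
    ι n = n · 1#

    Differences : RawRing _ _
    Differences = record
      { Carrier = ℕ × ℕ
      ; _≈_ = ≡._≡_
      ; _+_ = λ { (a , b) (c , d) → (a ℕ.+ c , b ℕ.+ d) }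
      ; _*_ = λ { (a , b) (c , d) → (a ℕ.* c ℕ.+ b ℕ.* d , a ℕ.* d ℕ.+ b ℕ.* c) }
      ; -_ = λ { (a , b) → (b , a) }
      ; 0# = (0 , 0)
      ; 1# = (1 , 0)
      }

    embed : ℕ × ℕ → Carrier
    embed (a , b) = ι a - ι b

    ι-+ : ∀ m n → ι (m ℕ.+ n) ≈ ι m + ι n
    ι-+ = ×-homo-+ 1#

    ι-* : ∀ m n → ι (m ℕ.* n) ≈ ι m * ι n
    ι-* = ×1-homo-*

    -‿homo-+ : ∀ x y → - (x + y) ≈ - x + - y
    -‿homo-+ x y = sym (-‿+-comm x y)

    embed-homo-+ : ∀ a b c d → embed (a ℕ.+ c , b ℕ.+ d) ≈ embed (a , b) + embed (c , d)
    embed-homo-+ a b c d = begin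
      ι (a ℕ.+ c) - ι (b ℕ.+ d)         ≈⟨ +-cong (ι-+ a c) (-‿cong (ι-+ b d)) ⟩
      (ι a + ι c) + - (ι b + ι d)       ≈⟨ +-congˡ (-‿homo-+ (ι b) (ι d)) ⟩
      (ι a + ι c) + (- ι b + - ι d)     ≈⟨ interchange _ _ _ _ ⟩
      (ι a - ι b) + (ι c - ι d)         ∎

    difference-* : ∀ A B C D → (A - B) * (C - D) ≈ (A * C + B * D) - (A * D + B * C)
    difference-* A B C D = begin
      (A - B) * (C - D)                          ≈⟨ distribʳ _ _ _ ⟩
      A * (C - D) + - B * (C - D)                ≈⟨ +-cong (distribˡ _ _ _) (distribˡ _ _ _) ⟩
      (A * C + A * - D) + (- B * C + - B * - D)  ≈⟨ +-cong (+-congˡ (sym (-‿distribʳ-* A D))) (+-cong (sym (-‿distribˡ-* B C)) negneg) ⟩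
      (A * C - A * D) + (- (B * C) + B * D)      ≈⟨ +-congˡ (+-comm _ _) ⟩
      (A * C - A * D) + (B * D - B * C)          ≈⟨ interchange _ _ _ _ ⟩
      (A * C + B * D) + (- (A * D) + - (B * C))  ≈⟨ +-congˡ (sym (-‿homo-+ _ _)) ⟩
      (A * C + B * D) - (A * D + B * C)          ∎
      where
      negneg : - B * - D ≈ B * D
      negneg = trans (sym (-‿distribˡ-* B (- D))) (trans (-‿cong (sym (-‿distribʳ-* B D))) (-‿involutive _))

    embed-homo-* : ∀ a b c d → embed (a ℕ.* c ℕ.+ b ℕ.* d , a ℕ.* d ℕ.+ b ℕ.* c) ≈ embed (a , b) * embed (c , d)
    embed-homo-* a b c d = begin
      ι (a ℕ.* c ℕ.+ b ℕ.* d) - ι (a ℕ.* d ℕ.+ b ℕ.* c)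
        ≈⟨ +-cong (ι-+* a c b d) (-‿cong (ι-+* a d b c)) ⟩
      (ι a * ι c + ι b * ι d) - (ι a * ι d + ι b * ι c)  ≈⟨ sym (difference-* _ _ _ _) ⟩
      (ι a - ι b) * (ι c - ι d)                         ∎
      where
      ι-+* : ∀ p q s t → ι (p ℕ.* q ℕ.+ s ℕ.* t) ≈ ι p * ι q + ι s * ι t
      ι-+* p q s t = trans (ι-+ (p ℕ.* q) (s ℕ.* t)) (+-cong (ι-* p q) (ι-* s t))

    embed-sound : ∀ a b c d → a ℕ.+ d ≡.≡ c ℕ.+ b → embed (a , b) ≈ embed (c , d)
    embed-sound a b c d eq = x∙y⁻¹≈ε⇒x≈y _ _ (begin
      (ι a - ι b) - (ι c - ι d)          ≈⟨ +-congˡ (⁻¹-anti-homo‿- (ι c) (ι d)) ⟩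
      (ι a - ι b) + (ι d - ι c)          ≈⟨ interchange _ _ _ _ ⟩
      (ι a + ι d) + (- ι b - ι c)        ≈⟨ +-cong (trans (sym (ι-+ a d)) (trans (reflexive (≡.cong ι eq)) (ι-+ c b))) (sym (-‿homo-+ _ _)) ⟩
      (ι c + ι b) - (ι b + ι c)          ≈⟨ +-congʳ (+-comm _ _) ⟩
      (ι b + ι c) - (ι b + ι c)          ≈⟨ -‿inverseʳ _ ⟩
      0#                                 ∎)

    morphism : Differences -Raw-AlmostCommutative⟶ fromCommutativeRing R
    morphism = record
      { ⟦_⟧ = embed
      ; +-homo = λ { (a , b) (c , d) → embed-homo-+ a b c d }
      ; *-homo = λ { (a , b) (c , d) → embed-homo-* a b c d }
      ; -‿homo = λ { (a , b) → sym (⁻¹-anti-homo‿- (ι a) (ι b)) }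
      ; 0-homo = -‿inverseʳ 0#
      ; 1-homo = trans (+-congˡ -0#≈0#) (trans (+-identityʳ _) (+-identityʳ 1#))
      }

    equal? : ∀ x y → Maybe (embed x ≈ embed y)
    equal? (a , b) (c , d) with a ℕ.+ d ℕ.≟ c ℕ.+ b
    ... | yes eq = just (embed-sound a b c d eq)
    ... | no _   = nothing

  open import Algebra.Solver.Ring Differences (fromCommutativeRing R) morphism equal? public

module PolynomialRing {c r} (F : Field c r) (ℓ : ℕ) (N : ℕ → List (Field.Carrier F)) where
  open Field F
  open Arr F ℓ N
  open import Relation.Binary.Reasoning.Setoid setoid
  open import Algebra.Properties.Ring ring using (-0#≈0#; -‿+-comm)
  open import Algebra.Properties.CommutativeSemigroup +-commutativeSemigroup using (interchange)

  Term : Set c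
  Term = Carrier × Mono

  infixl 6 _⊕_
  _⊕_ : ∀ {n} → Vec ℕ n → Vec ℕ n → Vec ℕ n
  _⊕_ = zipWith ℕ._+_

  ⊕-comm : ∀ {n} (e f : Vec ℕ n) → e ⊕ f ≡ f ⊕ e
  ⊕-comm = Vec.zipWith-comm ℕ.+-comm

  ⊕-assoc : ∀ {n} (e f g : Vec ℕ n) → (e ⊕ f) ⊕ g ≡ e ⊕ (f ⊕ g)
  ⊕-assoc = Vec.zipWith-assoc ℕ.+-assoc

  ⊕-identityˡ : ∀ {n} (e : Vec ℕ n) → replicate n 0 ⊕ e ≡ e
  ⊕-identityˡ = Vec.zipWith-identityˡ ℕ.+-identityˡ

  ⊕-cancelˡ : ∀ {n} (e f g : Vec ℕ n) → e ⊕ f ≡ e ⊕ g → f ≡ g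
  ⊕-cancelˡ Vec.[] Vec.[] Vec.[] _ = ≡.refl
  ⊕-cancelˡ (x Vec.∷ e) (y Vec.∷ f) (z Vec.∷ g) eq =
    ≡.cong₂ Vec._∷_ (ℕ.+-cancelˡ-≡ x y z (≡.cong Vec.head eq)) (⊕-cancelˡ e f g (≡.cong Vec.tail eq))

  _⊖_ : ∀ {n} → Vec ℕ n → Vec ℕ n → Vec ℕ n
  _⊖_ = zipWith ℕ._∸_

  ⊕-⊖ : ∀ {n} (e f : Vec ℕ n) → (e ⊕ f) ⊖ e ≡ f
  ⊕-⊖ Vec.[] Vec.[] = ≡.refl
  ⊕-⊖ (x Vec.∷ e) (y Vec.∷ f) = ≡.cong₂ Vec._∷_ (ℕ.m+n∸m≡n x y) (⊕-⊖ e f)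

  termMul : Term → Term → Term
  termMul (a , e) (b , f) = (a * b , e ⊕ f)

  Σₜ : (Term → Carrier) → Poly → Carrier
  Σₜ g [] = 0#
  Σₜ g (t ∷ p) = g t + Σₜ g p

  coeffₜ : Term → Mono → Carrier
  coeffₜ t m = coeff (t ∷ []) m

  coeff-cons : ∀ t p m → coeff (t ∷ p) m ≈ coeffₜ t m + coeff p m
  coeff-cons (a , e) p m with Vec.≡-dec ℕ._≟_ e m
  ... | yes _ = +-congʳ (sym (+-identityʳ a))
  ... | no _ = sym (+-identityˡ _)

  coeffₜ-self : ∀ a e → coeffₜ (a , e) e ≈ a
  coeffₜ-self a e with Vec.≡-dec ℕ._≟_ e e
  ... | yes _ = +-identityʳ a
  ... | no ne = ⊥-elim (ne ≡.refl)

  coeffₜ-other : ∀ a e m → ¬ (e ≡ m) → coeffₜ (a , e) m ≈ 0#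
  coeffₜ-other a e m ne with Vec.≡-dec ℕ._≟_ e m
  ... | yes eq = ⊥-elim (ne eq)
  ... | no _ = refl

  coeffₜ-cong : ∀ {a b} e m → a ≈ b → coeffₜ (a , e) m ≈ coeffₜ (b , e) m
  coeffₜ-cong {a} {b} e m a≈b with Vec.≡-dec ℕ._≟_ e m
  ... | yes _ = +-congʳ a≈b
  ... | no _ = refl

  coeff-sum : ∀ p m → coeff p m ≈ Σₜ (λ t → coeffₜ t m) p
  coeff-sum [] m = refl
  coeff-sum (t ∷ p) m = trans (coeff-cons t p m) (+-congˡ (coeff-sum p m))

  coeff-++ : ∀ p q m → coeff (p ++ q) m ≈ coeff p m + coeff q m
  coeff-++ [] q m = sym (+-identityˡ _)
  coeff-++ (t ∷ p) q m = begin
    coeff (t ∷ (p ++ q)) m ≈⟨ coeff-cons t (p ++ q) m ⟩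
    coeffₜ t m + coeff (p ++ q) m ≈⟨ +-congˡ (coeff-++ p q m) ⟩
    coeffₜ t m + (coeff p m + coeff q m) ≈⟨ sym (+-assoc _ _ _) ⟩
    (coeffₜ t m + coeff p m) + coeff q m ≈⟨ +-congʳ (sym (coeff-cons t p m)) ⟩
    coeff (t ∷ p) m + coeff q m ∎

  Σₜ-cong : ∀ {g h} p → (∀ t → g t ≈ h t) → Σₜ g p ≈ Σₜ h p
  Σₜ-cong [] e = refl
  Σₜ-cong (t ∷ p) e = +-cong (e t) (Σₜ-cong p e)

  Σₜ-++ : ∀ g p q → Σₜ g (p ++ q) ≈ Σₜ g p + Σₜ g q
  Σₜ-++ g [] q = sym (+-identityˡ _)
  Σₜ-++ g (t ∷ p) q = trans (+-congˡ (Σₜ-++ g p q)) (sym (+-assoc _ _ _))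

  Σₜ-map : ∀ g f p → Σₜ g (map f p) ≡ Σₜ (λ t → g (f t)) p
  Σₜ-map g f [] = ≡.refl
  Σₜ-map g f (t ∷ p) = ≡.cong (g (f t) +_) (Σₜ-map g f p)

  Σₜ-+ : ∀ g h p → Σₜ (λ t → g t + h t) p ≈ Σₜ g p + Σₜ h p
  Σₜ-+ g h [] = sym (+-identityˡ _)
  Σₜ-+ g h (t ∷ p) = begin
    (g t + h t) + Σₜ (λ t → g t + h t) p ≈⟨ +-congˡ (Σₜ-+ g h p) ⟩
    (g t + h t) + (Σₜ g p + Σₜ h p) ≈⟨ interchange _ _ _ _ ⟩
    (g t + Σₜ g p) + (h t + Σₜ h p) ∎

  Σₜ-0 : ∀ p → Σₜ (λ _ → 0#) p ≈ 0#
  Σₜ-0 [] = refl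
  Σₜ-0 (t ∷ p) = trans (+-identityˡ _) (Σₜ-0 p)

  Σₜ-swap : ∀ (G : Term → Term → Carrier) p q →
    Σₜ (λ t → Σₜ (λ u → G t u) q) p ≈ Σₜ (λ u → Σₜ (λ t → G t u) p) q
  Σₜ-swap G [] q = sym (Σₜ-0 q)
  Σₜ-swap G (t ∷ p) q = begin
    Σₜ (λ u → G t u) q + Σₜ (λ t → Σₜ (λ u → G t u) q) p ≈⟨ +-congˡ (Σₜ-swap G p q) ⟩
    Σₜ (λ u → G t u) q + Σₜ (λ u → Σₜ (λ t → G t u) p) q ≈⟨ sym (Σₜ-+ _ _ q) ⟩
    Σₜ (λ u → G t u + Σₜ (λ t → G t u) p) q ∎

  coeff-map : ∀ f p m → coeff (map f p) m ≈ Σₜ (λ u → coeffₜ (f u) m) p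
  coeff-map f p m = trans (coeff-sum (map f p) m) (reflexive (Σₜ-map (λ t → coeffₜ t m) f p))

  coeff-mul : ∀ p q m → coeff (p *P q) m ≈ Σₜ (λ t → Σₜ (λ u → coeffₜ (termMul t u) m) q) p
  coeff-mul [] q m = refl
  coeff-mul (t ∷ p) q m = trans (coeff-++ (map (termMul t) q) (p *P q) m)
    (+-cong (coeff-map (termMul t) q m) (coeff-mul p q m))

  Σₜ-mul : ∀ G p q → Σₜ G (p *P q) ≈ Σₜ (λ t → Σₜ (λ u → G (termMul t u)) q) p
  Σₜ-mul G [] q = refl
  Σₜ-mul G (t ∷ p) q = trans (Σₜ-++ G (map (termMul t) q) (p *P q))
    (+-cong (reflexive (Σₜ-map G (termMul t) q)) (Σₜ-mul G p q))

  coeffₜ-neg : ∀ a e m → coeffₜ (- a , e) m ≈ - coeffₜ (a , e) m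
  coeffₜ-neg a e m with Vec.≡-dec ℕ._≟_ e m
  ... | yes _ = trans (+-identityʳ _) (-‿cong (sym (+-identityʳ a)))
  ... | no _ = sym -0#≈0#

  coeffₜ-zero : ∀ e m → coeffₜ (0# , e) m ≈ 0#
  coeffₜ-zero e m with Vec.≡-dec ℕ._≟_ e m
  ... | yes _ = +-identityˡ 0#
  ... | no _  = refl

  coeffₜ-+ : ∀ a b e m → coeffₜ (a + b , e) m ≈ coeffₜ (a , e) m + coeffₜ (b , e) m
  coeffₜ-+ a b e m with Vec.≡-dec ℕ._≟_ e m
  ... | yes _ = trans (+-identityʳ _) (+-cong (sym (+-identityʳ a)) (sym (+-identityʳ b)))
  ... | no _  = sym (+-identityˡ 0#)

  coeff-neg : ∀ p m → coeff (-P p) m ≈ - coeff p m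
  coeff-neg [] m = sym -0#≈0#
  coeff-neg ((a , e) ∷ p) m = begin
    coeff ((- a , e) ∷ -P p) m ≈⟨ coeff-cons (- a , e) (-P p) m ⟩
    coeffₜ (- a , e) m + coeff (-P p) m ≈⟨ +-cong (coeffₜ-neg a e m) (coeff-neg p m) ⟩
    - coeffₜ (a , e) m + - coeff p m ≈⟨ -‿+-comm _ _ ⟩
    - (coeffₜ (a , e) m + coeff p m) ≈⟨ -‿cong (sym (coeff-cons (a , e) p m)) ⟩
    - coeff ((a , e) ∷ p) m ∎

  ⊕-divides? : ∀ (e m : Mono) → (Σ Mono λ m' → e ⊕ m' ≡ m) ⊎ (∀ f → ¬ (e ⊕ f ≡ m))
  ⊕-divides? e m with Vec.≡-dec ℕ._≟_ (e ⊕ (m ⊖ e)) m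
  ... | yes eq = inj₁ (m ⊖ e , eq)
  ... | no ne = inj₂ (λ f eq → ne (≡.trans (≡.cong (e ⊕_) (≡.trans (≡.cong (_⊖ e) (≡.sym eq)) (⊕-⊖ e f))) eq))

  coeff-shift : ∀ a e m m' → e ⊕ m' ≡ m → ∀ q → coeff (map (termMul (a , e)) q) m ≈ a * coeff q m'
  coeff-shift a e m m' eq [] = sym (zeroʳ a)
  coeff-shift a e m m' eq ((b , f) ∷ q) = begin
    coeff ((a * b , e ⊕ f) ∷ map (termMul (a , e)) q) m ≈⟨ coeff-cons (a * b , e ⊕ f) (map (termMul (a , e)) q) m ⟩
    coeffₜ (a * b , e ⊕ f) m + coeff (map (termMul (a , e)) q) m ≈⟨ +-cong (lem (Vec.≡-dec ℕ._≟_ f m')) (coeff-shift a e m m' eq q) ⟩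
    a * coeffₜ (b , f) m' + a * coeff q m' ≈⟨ sym (distribˡ a _ _) ⟩
    a * (coeffₜ (b , f) m' + coeff q m') ≈⟨ *-congˡ (sym (coeff-cons (b , f) q m')) ⟩
    a * coeff ((b , f) ∷ q) m' ∎
    where
    lem : Dec (f ≡ m') → coeffₜ (a * b , e ⊕ f) m ≈ a * coeffₜ (b , f) m'
    lem (yes ≡.refl) = ≡.subst (λ m → coeffₜ (a * b , e ⊕ f) m ≈ a * coeffₜ (b , f) f) eq
      (trans (coeffₜ-self (a * b) (e ⊕ f)) (*-congˡ (sym (coeffₜ-self b f))))
    lem (no ne) = trans (coeffₜ-other _ _ m (λ eq' → ne (⊕-cancelˡ e f m' (≡.trans eq' (≡.sym eq)))))
      (sym (trans (*-congˡ (coeffₜ-other b f m' ne)) (zeroʳ a)))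

  coeff-shift-miss : ∀ a e m → (∀ f → ¬ (e ⊕ f ≡ m)) → ∀ q → coeff (map (termMul (a , e)) q) m ≈ 0#
  coeff-shift-miss a e m ne [] = refl
  coeff-shift-miss a e m ne ((b , f) ∷ q) = trans (coeff-cons (a * b , e ⊕ f) (map (termMul (a , e)) q) m)
    (trans (+-cong (coeffₜ-other (a * b) (e ⊕ f) m (ne f)) (coeff-shift-miss a e m ne q)) (+-identityˡ 0#))

  coeff-shift-cong : ∀ t m q q' → q ≈P q' → coeff (map (termMul t) q) m ≈ coeff (map (termMul t) q') m
  coeff-shift-cong (a , e) m q q' eqq with ⊕-divides? e m
  ... | inj₁ (m' , eq) = trans (coeff-shift a e m m' eq q) (trans (*-congˡ (eqq m')) (sym (coeff-shift a e m m' eq q')))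
  ... | inj₂ ne = trans (coeff-shift-miss a e m ne q) (sym (coeff-shift-miss a e m ne q'))

  coeff-*P-shifts : ∀ p q m → coeff (p *P q) m ≈ Σₜ (λ t → coeff (map (termMul t) q) m) p
  coeff-*P-shifts [] q m = refl
  coeff-*P-shifts (t ∷ p) q m = trans (coeff-++ (map (termMul t) q) (p *P q) m) (+-congˡ (coeff-*P-shifts p q m))

  *P-congʳ : ∀ p {q q'} → q ≈P q' → p *P q ≈P p *P q'
  *P-congʳ p {q} {q'} e m = trans (coeff-*P-shifts p q m)
    (trans (Σₜ-cong p (λ t → coeff-shift-cong t m q q' e)) (sym (coeff-*P-shifts p q' m)))

  coeffₜ-termMul-comm : ∀ t u m → coeffₜ (termMul t u) m ≈ coeffₜ (termMul u t) m
  coeffₜ-termMul-comm (a , e) (b , f) m =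
    ≡.subst (λ g → coeffₜ (a * b , e ⊕ f) m ≈ coeffₜ (b * a , g) m) (⊕-comm e f) (coeffₜ-cong (e ⊕ f) m (*-comm a b))

  *P-comm : ∀ p q → p *P q ≈P q *P p
  *P-comm p q m = begin
    coeff (p *P q) m ≈⟨ coeff-mul p q m ⟩
    Σₜ (λ t → Σₜ (λ u → coeffₜ (termMul t u) m) q) p ≈⟨ Σₜ-swap (λ t u → coeffₜ (termMul t u) m) p q ⟩
    Σₜ (λ u → Σₜ (λ t → coeffₜ (termMul t u) m) p) q ≈⟨ Σₜ-cong q (λ u → Σₜ-cong p (λ t → coeffₜ-termMul-comm t u m)) ⟩
    Σₜ (λ u → Σₜ (λ t → coeffₜ (termMul u t) m) p) q ≈⟨ sym (coeff-mul q p m) ⟩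
    coeff (q *P p) m ∎

  *P-cong : ∀ {p p' q q'} → p ≈P p' → q ≈P q' → p *P q ≈P p' *P q'
  *P-cong {p} {p'} {q} {q'} e e' m =
    trans (*P-congʳ p e' m) (trans (*P-comm p q' m) (trans (*P-congʳ q' e m) (*P-comm q' p' m)))

  coeffₜ-termMul-assoc : ∀ t u w m → coeffₜ (termMul (termMul t u) w) m ≈ coeffₜ (termMul t (termMul u w)) m
  coeffₜ-termMul-assoc (a , e) (b , f) (d , g) m =
    ≡.subst (λ h → coeffₜ ((a * b) * d , (e ⊕ f) ⊕ g) m ≈ coeffₜ (a * (b * d) , h) m) (⊕-assoc e f g)
            (coeffₜ-cong ((e ⊕ f) ⊕ g) m (*-assoc a b d))

  *P-assoc : ∀ p q s → (p *P q) *P s ≈P p *P (q *P s)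
  *P-assoc p q s m = begin
    coeff ((p *P q) *P s) m ≈⟨ coeff-mul (p *P q) s m ⟩
    Σₜ (λ v → Σₜ (λ w → coeffₜ (termMul v w) m) s) (p *P q) ≈⟨ Σₜ-mul (λ v → Σₜ (λ w → coeffₜ (termMul v w) m) s) p q ⟩
    Σₜ (λ t → Σₜ (λ u → Σₜ (λ w → coeffₜ (termMul (termMul t u) w) m) s) q) p
      ≈⟨ Σₜ-cong p (λ t → Σₜ-cong q (λ u → Σₜ-cong s (λ w → coeffₜ-termMul-assoc t u w m))) ⟩
    Σₜ (λ t → Σₜ (λ u → Σₜ (λ w → coeffₜ (termMul t (termMul u w)) m) s) q) p
      ≈⟨ Σₜ-cong p (λ t → sym (Σₜ-mul (λ v → coeffₜ (termMul t v) m) q s)) ⟩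
    Σₜ (λ t → Σₜ (λ v → coeffₜ (termMul t v) m) (q *P s)) p ≈⟨ sym (coeff-mul p (q *P s) m) ⟩
    coeff (p *P (q *P s)) m ∎

  *P-distribˡ : ∀ p q s → p *P (q +P s) ≈P (p *P q) +P (p *P s)
  *P-distribˡ p q s m = begin
    coeff (p *P (q ++ s)) m ≈⟨ coeff-mul p (q ++ s) m ⟩
    Σₜ (λ t → Σₜ (λ u → coeffₜ (termMul t u) m) (q ++ s)) p ≈⟨ Σₜ-cong p (λ t → Σₜ-++ _ q s) ⟩
    Σₜ (λ t → Σₜ (λ u → coeffₜ (termMul t u) m) q + Σₜ (λ u → coeffₜ (termMul t u) m) s) p ≈⟨ Σₜ-+ _ _ p ⟩
    Σₜ (λ t → Σₜ (λ u → coeffₜ (termMul t u) m) q) p + Σₜ (λ t → Σₜ (λ u → coeffₜ (termMul t u) m) s) p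
      ≈⟨ sym (+-cong (coeff-mul p q m) (coeff-mul p s m)) ⟩
    coeff (p *P q) m + coeff (p *P s) m ≈⟨ sym (coeff-++ (p *P q) (p *P s) m) ⟩
    coeff ((p *P q) +P (p *P s)) m ∎

  *P-distribʳ : ∀ p q s → (q +P s) *P p ≈P (q *P p) +P (s *P p)
  *P-distribʳ p q s m = begin
    coeff ((q +P s) *P p) m               ≈⟨ *P-comm (q +P s) p m ⟩
    coeff (p *P (q +P s)) m               ≈⟨ *P-distribˡ p q s m ⟩
    coeff (p *P q +P p *P s) m            ≈⟨ coeff-++ (p *P q) (p *P s) m ⟩
    coeff (p *P q) m + coeff (p *P s) m   ≈⟨ +-cong (*P-comm p q m) (*P-comm p s m) ⟩
    coeff (q *P p) m + coeff (s *P p) m   ≈⟨ coeff-++ (q *P p) (s *P p) m ⟨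
    coeff (q *P p +P s *P p) m            ∎

  *P-identityˡ : ∀ p → 1P *P p ≈P p
  *P-identityˡ p m = begin
    coeff (1P *P p) m ≈⟨ coeff-mul 1P p m ⟩
    Σₜ (λ u → coeffₜ (termMul (1# , replicate _ 0) u) m) p + 0# ≈⟨ +-identityʳ _ ⟩
    Σₜ (λ u → coeffₜ (termMul (1# , replicate _ 0) u) m) p ≈⟨ Σₜ-cong p lem ⟩
    Σₜ (λ u → coeffₜ u m) p ≈⟨ sym (coeff-sum p m) ⟩
    coeff p m ∎
    where
    lem : ∀ u → coeffₜ (termMul (1# , replicate _ 0) u) m ≈ coeffₜ u m
    lem (b , f) = ≡.subst (λ g → coeffₜ (1# * b , replicate _ 0 ⊕ f) m ≈ coeffₜ (b , g) m) (⊕-identityˡ f)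
                          (coeffₜ-cong (replicate _ 0 ⊕ f) m (*-identityˡ b))

  +P-assoc : ∀ p q s → (p +P q) +P s ≈P p +P (q +P s)
  +P-assoc p q s m = reflexive (≡.cong (λ l → coeff l m) (List.++-assoc p q s))

  +P-comm : ∀ p q → p +P q ≈P q +P p
  +P-comm p q m = trans (coeff-++ p q m) (trans (+-comm _ _) (sym (coeff-++ q p m)))

  +P-cong : ∀ {p p' q q'} → p ≈P p' → q ≈P q' → p +P q ≈P p' +P q'
  +P-cong {p} {p'} {q} {q'} e1 e2 m = trans (coeff-++ p q m) (trans (+-cong (e1 m) (e2 m)) (sym (coeff-++ p' q' m)))

  -P-cong : ∀ {p q} → p ≈P q → -P p ≈P -P q
  -P-cong {p} {q} e m = trans (coeff-neg p m) (trans (-‿cong (e m)) (sym (coeff-neg q m)))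

  -P-inverseˡ : ∀ p → (-P p) +P p ≈P 0P
  -P-inverseˡ p m = trans (coeff-++ (-P p) p m) (trans (+-congʳ (coeff-neg p m)) (-‿inverseˡ _))

  -P-inverseʳ : ∀ p → p +P (-P p) ≈P 0P
  -P-inverseʳ p m = trans (coeff-++ p (-P p) m) (trans (+-congˡ (coeff-neg p m)) (-‿inverseʳ _))

  +P-identityʳ : ∀ p → p +P 0P ≈P p
  +P-identityʳ p m = reflexive (≡.cong (λ l → coeff l m) (List.++-identityʳ p))

  -- Wrapping _≈P_ in a record makes the relation injective, so that its arguments can be inferred.
  infix 4 _≋_
  record _≋_ (p q : Poly) : Set r where
    constructor mk
    field get : p ≈P q
  open _≋_ public

  isCommutativeRing-≋ : IsCommutativeRing _≋_ _+P_ _*P_ -P_ 0P 1P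
  isCommutativeRing-≋ = record
    { isRing = record
      { +-isAbelianGroup = record
        { isGroup = record
          { isMonoid = record
            { isSemigroup = record
              { isMagma = record
                { isEquivalence = record
                  { refl = mk (λ m → refl)
                  ; sym = λ e → mk (λ m → sym (get e m))
                  ; trans = λ e e' → mk (λ m → trans (get e m) (get e' m)) }
                ; ∙-cong = λ {p} {p'} {q} {q'} e e' → mk (+P-cong {p} {p'} {q} {q'} (get e) (get e')) }
              ; assoc = λ p q s → mk (+P-assoc p q s) }
            ; identity = (λ p → mk (λ m → refl)) , (λ p → mk (+P-identityʳ p)) }
          ; inverse = (λ p → mk (-P-inverseˡ p)) , (λ p → mk (-P-inverseʳ p))
          ; ⁻¹-cong = λ {p} {q} e → mk (-P-cong {p} {q} (get e)) }
        ; comm = λ p q → mk (+P-comm p q) }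
      ; *-cong = λ {p} {p'} {q} {q'} e e' → mk (*P-cong {p} {p'} {q} {q'} (get e) (get e'))
      ; *-assoc = λ p q s → mk (*P-assoc p q s)
      ; *-identity = (λ p → mk (*P-identityˡ p)) , (λ p → mk (λ m → trans (*P-comm p 1P m) (*P-identityˡ p m)))
      ; distrib = (λ p q s → mk (*P-distribˡ p q s)) , (λ p q s → mk (*P-distribʳ p q s)) }
    ; *-comm = λ p q → mk (*P-comm p q) }

  polynomialRing : CommutativeRing c r
  polynomialRing = record { isCommutativeRing = isCommutativeRing-≋ }

module LinearFactors {c r} (F : Field c r) (ℓ : ℕ) (N : ℕ → List (Field.Carrier F)) where
  open Field F
  open Arr F ℓ N
  open PolynomialRing F ℓ N
  module P = CommutativeRing polynomialRing
  module ≈-Reasoning = Relation.Binary.Reasoning.Setoid setoid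
  module ≋-Reasoning = Relation.Binary.Reasoning.Setoid P.setoid
  open FormalDifferenceSolver polynomialRing using (solve; _:+_; _:*_; _:-_; _:=_)

  if-true : ∀ {a} {A : Set a} {b} {x y : A} → T b → (if b then x else y) ≡ x
  if-true {b = true} _ = ≡.refl

  if-false : ∀ {a} {A : Set a} {b} {x y : A} → ¬ T b → (if b then x else y) ≡ y
  if-false {b = true}  ¬b = ⊥-elim (¬b _)
  if-false {b = false} _  = ≡.refl

  Var : Set
  Var = Fin (suc ℓ)

  δ : ℕ → Mono
  δ i = tabulate (λ j → if toℕ j ≡ᵇ i then 1 else 0)

  exponent : Mono → Var → ℕ
  exponent = Vec.lookup

  exponent-δ-≡ : ∀ v → exponent (δ (toℕ v)) v ≡ 1
  exponent-δ-≡ v = ≡.trans (Vec.lookup∘tabulate (λ j → if toℕ j ≡ᵇ toℕ v then 1 else 0) v)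
                           (if-true (ℕ.≡⇒≡ᵇ (toℕ v) (toℕ v) ≡.refl))

  exponent-δ-≢ : ∀ i w → toℕ w ≢ i → exponent (δ i) w ≡ 0
  exponent-δ-≢ i w ne = ≡.trans (Vec.lookup∘tabulate (λ j → if toℕ j ≡ᵇ i then 1 else 0) w) (if-false (ne ∘ ℕ.≡ᵇ⇒≡ (toℕ w) i))

  exponent-⊕ : ∀ e f v → exponent (e ⊕ f) v ≡ exponent e v ℕ.+ exponent f v
  exponent-⊕ e f v = Vec.lookup-zipWith ℕ._+_ v e f

  exponent-⊖ : ∀ e f v → exponent (e ⊖ f) v ≡ exponent e v ℕ.∸ exponent f v
  exponent-⊖ e f v = Vec.lookup-zipWith ℕ._∸_ v e f

  DegreeAtMost : Var → ℕ → Poly → Set c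
  DegreeAtMost v n p = All (λ t → exponent (proj₂ t) v ≤ n) p

  FreeOf : Var → Poly → Set c
  FreeOf v = DegreeAtMost v 0

  degree-bound : ∀ v p → ∃ λ n → DegreeAtMost v n p
  degree-bound v [] = 0 , []
  degree-bound v ((a , e) ∷ p) with degree-bound v p
  ... | n , hs = exponent e v ℕ.⊔ n , ℕ.m≤m⊔n _ _ ∷ All.map (λ h → ℕ.≤-trans h (ℕ.m≤n⊔m _ _)) hs

  DegreeAtMost-mono : ∀ {v n n' p} → n ≤ n' → DegreeAtMost v n p → DegreeAtMost v n' p
  DegreeAtMost-mono le = All.map (λ h → ℕ.≤-trans h le)

  DegreeAtMost-neg : ∀ {v n} p → DegreeAtMost v n p → DegreeAtMost v n (-P p)
  DegreeAtMost-neg p = All.map⁺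

  DegreeAtMost-*P : ∀ {v m n} p q → DegreeAtMost v m p → DegreeAtMost v n q → DegreeAtMost v (m ℕ.+ n) (p *P q)
  DegreeAtMost-*P [] q _ _ = []
  DegreeAtMost-*P {v} ((a , e) ∷ p) q (he ∷ hp) hq =
    All.++⁺ (All.map⁺ (All.map (λ {t} h → ≡.subst (_≤ _) (≡.sym (exponent-⊕ e (proj₂ t) v)) (ℕ.+-mono-≤ he h)) hq))
            (DegreeAtMost-*P p q hp hq)

  coeff-above-degree : ∀ {v n} p → DegreeAtMost v n p → ∀ m → n < exponent m v → coeff p m ≈ 0#
  coeff-above-degree [] _ m _ = refl
  coeff-above-degree {v} {n} ((a , e) ∷ p) (h ∷ hs) m lt =
    trans (coeff-cons (a , e) p m) (trans (+-cong (coeffₜ-other a e m e≢m) (coeff-above-degree p hs m lt)) (+-identityˡ 0#))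
    where
    e≢m : e ≢ m
    e≢m ≡.refl = ℕ.<⇒≱ lt h

  FreeOf-*P-coeff : ∀ v p q M → FreeOf v p →
    (∀ m → exponent m v ≡ exponent M v → coeff q m ≈ 0#) → coeff (p *P q) M ≈ 0#
  FreeOf-*P-coeff v [] q M [] H = refl
  FreeOf-*P-coeff v ((b , g) ∷ p) q M (g0 ∷ fp) H =
    trans (coeff-++ (map (termMul (b , g)) q) (p *P q) M)
      (trans (+-cong shifted (FreeOf-*P-coeff v p q M fp H)) (+-identityˡ 0#))
    where
    shifted : coeff (map (termMul (b , g)) q) M ≈ 0#
    shifted with ⊕-divides? g M
    ... | inj₂ g∤M = coeff-shift-miss b g M g∤M q
    ... | inj₁ (m , ≡.refl) =
      trans (coeff-shift b g _ m ≡.refl q) (trans (*-congˡ (H m same-degree)) (zeroʳ b))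
      where
      same-degree : exponent m v ≡ exponent (g ⊕ m) v
      same-degree = ≡.sym (≡.trans (exponent-⊕ g m v) (≡.cong (ℕ._+ exponent m v) (ℕ.n≤0⇒n≡0 g0)))

  coeff-X*P : ∀ (v : Var) q m → coeff (X (toℕ v) *P q) (δ (toℕ v) ⊕ m) ≈ coeff q m
  coeff-X*P v q m = trans (coeff-++ (map (termMul (1# , δ (toℕ v))) q) [] (δ (toℕ v) ⊕ m))
    (trans (+-identityʳ _) (trans (coeff-shift 1# (δ (toℕ v)) _ m ≡.refl q) (*-identityˡ _)))

  linear : Var → Poly → Poly
  linear v β = X (toℕ v) -P β

  -- The coefficient of q at m is that of x_v q at x_v m, which equals the one of β q there
  -- (by hypothesis), and β q only sees coefficients of q of higher x_v-degree than m;
  -- so descend from above the x_v-degree of q.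
  linear-multiple-vanishing : ∀ v β → FreeOf v β → ∀ q →
    (∀ m → 1 ≤ exponent m v → coeff (linear v β *P q) m ≈ 0#) → q ≈P 0P
  linear-multiple-vanishing v β fβ q H m = descend (suc n) m (ℕ.m≤n+m (suc n) (exponent m v))
    where
    n : ℕ
    n = proj₁ (degree-bound v q)
    descend : ∀ k m → n < exponent m v ℕ.+ k → coeff q m ≈ 0#
    descend zero m lt = coeff-above-degree q (proj₂ (degree-bound v q)) m (≡.subst (n <_) (ℕ.+-identityʳ _) lt)
    descend (suc k) m lt = begin
      coeff q m                                          ≈⟨ coeff-X*P v q m ⟨
      coeff (X (toℕ v) *P q) M                           ≈⟨ +-identityʳ _ ⟨
      coeff (X (toℕ v) *P q) M + 0#                      ≈⟨ +-congˡ (FreeOf-*P-coeff v (-P β) q M (DegreeAtMost-neg β fβ) higher) ⟨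
      coeff (X (toℕ v) *P q) M + coeff (-P β *P q) M     ≈⟨ coeff-++ (X (toℕ v) *P q) (-P β *P q) M ⟨
      coeff (X (toℕ v) *P q +P -P β *P q) M              ≈⟨ *P-distribʳ q (X (toℕ v)) (-P β) M ⟨
      coeff (linear v β *P q) M                          ≈⟨ H M (≡.subst (1 ≤_) (≡.sym exponent-M) (s≤s z≤n)) ⟩
      0#                                                 ∎
      where
      open ≈-Reasoning
      M : Mono
      M = δ (toℕ v) ⊕ m
      exponent-M : exponent M v ≡ suc (exponent m v)
      exponent-M = ≡.trans (exponent-⊕ (δ (toℕ v)) m v) (≡.cong (ℕ._+ exponent m v) (exponent-δ-≡ v))
      higher : ∀ m' → exponent m' v ≡ exponent M v → coeff q m' ≈ 0#
      higher m' eq = descend k m' (≡.subst (λ d → n < d ℕ.+ k) (≡.sym (≡.trans eq exponent-M))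
                                     (≡.subst (n <_) (ℕ.+-suc (exponent m v) k) lt))

  linear-cancelˡ : ∀ v β → FreeOf v β → ∀ q → linear v β *P q ≋ 0P → q ≋ 0P
  linear-cancelˡ v β fβ q eq = mk (linear-multiple-vanishing v β fβ q (λ m _ → get eq m))

  coeff-constP*P : ∀ a q m → coeff (constP a *P q) m ≈ a * coeff q m
  coeff-constP*P a q m = trans (coeff-++ (map (termMul (a , replicate _ 0)) q) [] m)
    (trans (+-identityʳ _) (coeff-shift a (replicate _ 0) m m (⊕-identityˡ m) q))

  constP-cancelˡ : ∀ a → ¬ (a ≈ 0#) → ∀ q → constP a *P q ≋ 0P → q ≋ 0P
  constP-cancelˡ a a≉0 q eq with inverse a a≉0
  ... | a⁻¹ , aa⁻¹≈1 = mk λ m → begin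
    coeff q m               ≈⟨ *-identityˡ _ ⟨
    1# * coeff q m          ≈⟨ *-congʳ (trans (*-comm a⁻¹ a) aa⁻¹≈1) ⟨
    (a⁻¹ * a) * coeff q m   ≈⟨ *-assoc a⁻¹ a _ ⟩
    a⁻¹ * (a * coeff q m)   ≈⟨ *-congˡ (trans (sym (coeff-constP*P a q m)) (get eq m)) ⟩
    a⁻¹ * 0#                ≈⟨ zeroʳ a⁻¹ ⟩
    0#                      ∎
    where open ≈-Reasoning

  infix 4 _∣_
  record _∣_ (a b : Poly) : Set (c ⊔ r) where
    constructor divides
    field
      cofactor      : Poly
      factorisation : b ≋ a *P cofactor

  ∣-respʳ : ∀ {a b b'} → a ∣ b → b ≋ b' → a ∣ b'
  ∣-respʳ (divides q eq) eq' = divides q (P.trans (P.sym eq') eq)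

  ∣-respˡ : ∀ {a a' b} → a ∣ b → a ≋ a' → a' ∣ b
  ∣-respˡ (divides q eq) eq' = divides q (P.trans eq (P.*-congʳ eq'))

  record Division (v : Var) (β p : Poly) : Set (c ⊔ r) where
    field
      quotient remainder : Poly
      remainder-free     : FreeOf v remainder
      division           : p ≋ linear v β *P quotient +P remainder

  split-off-X : ∀ v e k → exponent e v ≡ suc k →
    e ≡ δ (toℕ v) ⊕ (e ⊖ δ (toℕ v)) × exponent (e ⊖ δ (toℕ v)) v ≡ k
  split-off-X v e k ek = ≡.sym (lookup-ext pointwise) , ≡.trans (exponent-⊖ e dv v) (≡.cong₂ ℕ._∸_ ek (exponent-δ-≡ v))
    where
    dv : Mono
    dv = δ (toℕ v)
    lookup-ext : ∀ {n} {u w : Vec ℕ n} → (∀ i → Vec.lookup u i ≡ Vec.lookup w i) → u ≡ w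
    lookup-ext {u = u} {w} eq =
      ≡.trans (≡.sym (Vec.tabulate∘lookup u)) (≡.trans (Vec.tabulate-cong eq) (Vec.tabulate∘lookup w))
    dv≤e : ∀ w → exponent dv w ≤ exponent e w
    dv≤e w with w Fin.≟ v
    ... | yes ≡.refl = ≡.subst₂ _≤_ (≡.sym (exponent-δ-≡ v)) (≡.sym ek) (s≤s z≤n)
    ... | no w≢v = ≡.subst (_≤ exponent e w) (≡.sym (exponent-δ-≢ (toℕ v) w (w≢v ∘ Fin.toℕ-injective))) z≤n
    pointwise : ∀ w → exponent (dv ⊕ (e ⊖ dv)) w ≡ exponent e w
    pointwise w = ≡.trans (exponent-⊕ dv (e ⊖ dv) w)
      (≡.trans (≡.cong (exponent dv w ℕ.+_) (exponent-⊖ e dv w)) (ℕ.m+[n∸m]≡n (dv≤e w)))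

  term-split : ∀ (v : Var) a e e' → e ≡ δ (toℕ v) ⊕ e' → ((a , e) ∷ []) ≋ X (toℕ v) *P ((a , e') ∷ [])
  term-split v a e e' ≡.refl = mk (λ m → coeffₜ-cong (δ (toℕ v) ⊕ e') m (sym (*-identityˡ a)))

  Division-free-term : ∀ {v β p} t → exponent (proj₂ t) v ≡ 0 → Division v β p → Division v β (t ∷ p)
  Division-free-term {v} {β} t t-free D = record
    { quotient       = quotient
    ; remainder      = t ∷ remainder
    ; remainder-free = ℕ.≤-reflexive t-free ∷ remainder-free
    ; division       = P.trans (P.+-congˡ division)
        (solve 4 (λ t α q r → t :+ (α :* q :+ r) := α :* q :+ (t :+ r)) P.refl (t ∷ []) (linear v β) quotient remainder)
    }
    where open Division D

  -- x_v t' = (x_v - β) t' + β t', and β t' is divided recursively.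
  Division-X-term : ∀ {v β p} t t' → (t ∷ []) ≋ X (toℕ v) *P t' →
    Division v β (β *P t') → Division v β p → Division v β (t ∷ p)
  Division-X-term {v} {β} {p} t t' t≋Xt' D₁ D = record
    { quotient       = (t' +P D₁.quotient) +P D.quotient
    ; remainder      = D₁.remainder +P D.remainder
    ; remainder-free = All.++⁺ D₁.remainder-free D.remainder-free
    ; division       = begin
        (t ∷ []) +P p
          ≈⟨ P.+-cong t≋Xt' D.division ⟩
        X (toℕ v) *P t' +P (linear v β *P D.quotient +P D.remainder)
          ≈⟨ solve 5 (λ x b t q r → x :* t :+ ((x :- b) :* q :+ r) := (x :- b) :* (t :+ q) :+ (b :* t :+ r))
                     P.refl (X (toℕ v)) β t' D.quotient D.remainder ⟩
        linear v β *P (t' +P D.quotient) +P (β *P t' +P D.remainder)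
          ≈⟨ P.+-congˡ {linear v β *P (t' +P D.quotient)} (P.+-congʳ {D.remainder} D₁.division) ⟩
        linear v β *P (t' +P D.quotient) +P ((linear v β *P D₁.quotient +P D₁.remainder) +P D.remainder)
          ≈⟨ solve 6 (λ a t q r q₁ r₁ → a :* (t :+ q) :+ ((a :* q₁ :+ r₁) :+ r) := a :* ((t :+ q₁) :+ q) :+ (r₁ :+ r))
                     P.refl (linear v β) t' D.quotient D.remainder D₁.quotient D₁.remainder ⟩
        linear v β *P ((t' +P D₁.quotient) +P D.quotient) +P (D₁.remainder +P D.remainder)
          ∎
    }
    where
    module D₁ = Division D₁
    module D = Division D
    open ≋-Reasoning

  remainder-only : ∀ v β p → FreeOf v p → Division v β p
  remainder-only v β p p-free = record
    { quotient = 0P ; remainder = p ; remainder-free = p-free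
    ; division = P.sym (P.trans (P.+-congʳ (P.zeroʳ (linear v β))) (P.+-identityˡ p)) }

  divide-term : ∀ {n p} v β → FreeOf v β → ∀ t → exponent (proj₂ t) v ≤ suc n →
    (∀ q → DegreeAtMost v n q → Division v β q) → Division v β p → Division v β (t ∷ p)
  divide-term {n} v β fβ (a , e) h divide-lower D with exponent e v in ek
  ... | zero  = Division-free-term (a , e) ek D
  ... | suc k = Division-X-term (a , e) t' (term-split v a e e' (proj₁ split)) (divide-lower (β *P t') degree-βt') D
    where
    e' : Mono
    e' = e ⊖ δ (toℕ v)
    split : e ≡ δ (toℕ v) ⊕ e' × exponent e' v ≡ k
    split = split-off-X v e k ek
    t' : Poly
    t' = (a , e') ∷ []
    degree-βt' : DegreeAtMost v n (β *P t')
    degree-βt' = DegreeAtMost-mono (ℕ.≤-pred h) (DegreeAtMost-*P β t' fβ (ℕ.≤-reflexive (proj₂ split) ∷ []))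

  divide : ∀ v β → FreeOf v β → ∀ n p → DegreeAtMost v n p → Division v β p
  divide v β fβ zero p dp = remainder-only v β p dp
  divide v β fβ (suc n) [] _ = remainder-only v β [] []
  divide v β fβ (suc n) (t ∷ p) (h ∷ dp) = divide-term v β fβ t h (divide v β fβ n) (divide v β fβ (suc n) p dp)

  divide-by-linear : ∀ v β → FreeOf v β → ∀ p → Division v β p
  divide-by-linear v β fβ p = divide v β fβ _ p (proj₂ (degree-bound v p))

  -- p ≡ residue modulo x_v - β, with the residue free of x_v and not a zero divisor:
  -- a certificate that p is coprime to x_v - β.
  record CoprimeTo (v : Var) (β p : Poly) : Set (c ⊔ r) where
    field
      factor residue : Poly
      residue-free   : FreeOf v residue
      residue-cancel : ∀ q → residue *P q ≋ 0P → q ≋ 0P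
      decomposition  : p ≋ factor *P linear v β +P residue

  -- Write q = α Q + R with R free of x_v. From p q = α h and p = K α + μ (K = factor, μ = residue)
  -- we get α d = μ R for d = h - K q - μ Q; a multiple of α free of x_v vanishes, so μ R = 0 and R = 0.
  coprime-divisor : ∀ v β → FreeOf v β → ∀ p → CoprimeTo v β p → ∀ q → linear v β ∣ p *P q → linear v β ∣ q
  coprime-divisor v β fβ p C q (divides h pq≋αh) = divides Q q≋αQ
    where
    open CoprimeTo C
    open Division (divide-by-linear v β fβ q) renaming (quotient to Q; remainder to R)
    α d : Poly
    α = linear v β
    d = h -P factor *P q -P residue *P Q
    αd≋μR : α *P d ≋ residue *P R
    αd≋μR = begin
      α *P d
        ≈⟨ solve 6 (λ a h k m g q → a :* (h :- k :* g :- m :* q) := (a :* h :- (k :* a :+ m) :* g) :+ m :* (g :- a :* q))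
                   P.refl α h factor residue q Q ⟩
      (α *P h -P (factor *P α +P residue) *P q) +P residue *P (q -P α *P Q)
        ≈⟨ P.+-cong (P.trans (P.+-congʳ (P.trans (P.sym pq≋αh) (P.*-congʳ decomposition))) (P.-‿inverseʳ ((factor *P α +P residue) *P q)))
                    (P.*-congˡ {residue} (P.trans (P.+-congʳ { -P (α *P Q)} division) (solve 3 (λ a q r → (a :* q :+ r) :- a :* q := r) P.refl α Q R))) ⟩
      0P +P residue *P R
        ≈⟨ P.+-identityˡ _ ⟩
      residue *P R
        ∎
      where open ≋-Reasoning
    d≈0 : d ≈P 0P
    d≈0 = linear-multiple-vanishing v β fβ d
      (λ m lt → trans (get αd≋μR m) (coeff-above-degree (residue *P R) (DegreeAtMost-*P residue R residue-free remainder-free) m lt))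
    R≋0 : R ≋ 0P
    R≋0 = residue-cancel R (P.trans (P.sym αd≋μR) (P.trans (P.*-congˡ {α} (mk d≈0)) (P.zeroʳ α)))
    q≋αQ : q ≋ α *P Q
    q≋αQ = P.trans division (P.trans (P.+-congˡ R≋0) (P.+-identityʳ _))

  record LinearFactor : Set c where
    field
      var       : Var
      rest      : Poly
      rest-free : FreeOf var rest

  toPoly : LinearFactor → Poly
  toPoly A = linear (LinearFactor.var A) (LinearFactor.rest A)

  Coprime : LinearFactor → LinearFactor → Set (c ⊔ r)
  Coprime A B = CoprimeTo (LinearFactor.var A) (LinearFactor.rest A) (toPoly B)

  ΠF : List LinearFactor → Poly
  ΠF As = ΠL (map toPoly As)

  coprime-divisor-ΠF : ∀ A Bs → All (Coprime A) Bs → ∀ q → toPoly A ∣ ΠF Bs *P q → toPoly A ∣ q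
  coprime-divisor-ΠF A [] [] q A∣q = ∣-respʳ A∣q (P.*-identityˡ q)
  coprime-divisor-ΠF A (B ∷ Bs) (A⊥B ∷ A⊥Bs) q A∣BBsq = coprime-divisor-ΠF A Bs A⊥Bs q
    (coprime-divisor var rest rest-free (toPoly B) A⊥B (ΠF Bs *P q) (∣-respʳ A∣BBsq (P.*-assoc (toPoly B) (ΠF Bs) q)))
    where open LinearFactor A

  ΠF-∣ : ∀ As → AllPairs Coprime As → ∀ h → All (λ A → toPoly A ∣ h) As → ΠF As ∣ h
  ΠF-∣ [] _ h _ = divides h (P.sym (P.*-identityˡ h))
  ΠF-∣ (A ∷ As) (A⊥As ∷ pairwise) h (A∣h ∷ As∣h) with ΠF-∣ As pairwise h As∣h
  ... | divides q h≋Πq with coprime-divisor-ΠF A As A⊥As q (∣-respʳ A∣h h≋Πq)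
  ...   | divides q' q≋Aq' = divides q' (P.trans h≋Πq (P.trans (P.*-congˡ {ΠF As} q≋Aq')
                         (solve 3 (λ p a g → p :* (a :* g) := (a :* p) :* g) P.refl (ΠF As) (toPoly A) q')))

  ΠF-cancelˡ : ∀ As q → ΠF As *P q ≋ 0P → q ≋ 0P
  ΠF-cancelˡ [] q eq = P.trans (P.sym (P.*-identityˡ q)) eq
  ΠF-cancelˡ (A ∷ As) q eq = ΠF-cancelˡ As q
    (linear-cancelˡ var rest rest-free (ΠF As *P q) (P.trans (P.sym (P.*-assoc (toPoly A) (ΠF As) q)) eq))
    where open LinearFactor A

module Derivations {c r} (F : Field c r) (ℓ : ℕ) (N : ℕ → List (Field.Carrier F)) where
  open Field F
  open Arr F ℓ N
  open PolynomialRing F ℓ N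
  open LinearFactors F ℓ N
  open FormalDifferenceSolver polynomialRing using (solve; _:+_; _:*_; _:-_; :-_; _:=_)

  ≡⇒≋ : ∀ {p q} → p ≡ q → p ≋ q
  ≡⇒≋ ≡.refl = P.refl

  ΣF-cong : ∀ {n} (f g : Fin n → Poly) → (∀ k → f k ≋ g k) → ΣF f ≋ ΣF g
  ΣF-cong {zero}  f g f≋g = P.refl
  ΣF-cong {suc n} f g f≋g = P.+-cong (f≋g Fin.zero) (ΣF-cong (f ∘ Fin.suc) (g ∘ Fin.suc) (f≋g ∘ Fin.suc))

  ΣF-zero : ∀ {n} (f : Fin n → Poly) → (∀ k → f k ≋ 0P) → ΣF f ≋ 0P
  ΣF-zero {zero}  f f≋0 = P.refl
  ΣF-zero {suc n} f f≋0 = P.trans (P.+-cong (f≋0 Fin.zero) (ΣF-zero (f ∘ Fin.suc) (f≋0 ∘ Fin.suc))) (P.+-identityˡ 0P)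

  ΣF-single : ∀ {n} (f : Fin n → Poly) j → (∀ k → k ≢ j → f k ≋ 0P) → ΣF f ≋ f j
  ΣF-single {suc n} f Fin.zero f≋0 =
    P.trans (P.+-congˡ {f Fin.zero} (ΣF-zero (f ∘ Fin.suc) (λ k → f≋0 (Fin.suc k) (λ ()))))
            (P.+-identityʳ (f Fin.zero))
  ΣF-single {suc n} f (Fin.suc j) f≋0 =
    P.trans (P.+-congʳ {ΣF (f ∘ Fin.suc)} (f≋0 Fin.zero (λ ())))
      (P.trans (P.+-identityˡ (ΣF (f ∘ Fin.suc)))
               (ΣF-single (f ∘ Fin.suc) j (λ k k≢j → f≋0 (Fin.suc k) (k≢j ∘ Fin.suc-injective))))

  ΣF-+ : ∀ {n} (f g : Fin n → Poly) → ΣF (λ k → f k +P g k) ≋ ΣF f +P ΣF g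
  ΣF-+ {zero}  f g = P.sym (P.+-identityˡ 0P)
  ΣF-+ {suc n} f g =
    P.trans (P.+-congˡ {f Fin.zero +P g Fin.zero} (ΣF-+ (f ∘ Fin.suc) (g ∘ Fin.suc)))
      (solve 4 (λ a b c d → (a :+ b) :+ (c :+ d) := (a :+ c) :+ (b :+ d)) P.refl
             (f Fin.zero) (g Fin.zero) (ΣF (f ∘ Fin.suc)) (ΣF (g ∘ Fin.suc)))

  ΣF-distribˡ : ∀ {n} p (f : Fin n → Poly) → p *P ΣF f ≋ ΣF (λ k → p *P f k)
  ΣF-distribˡ {zero}  p f = P.zeroʳ p
  ΣF-distribˡ {suc n} p f = P.trans (P.distribˡ p (f Fin.zero) (ΣF (f ∘ Fin.suc)))
    (P.+-congˡ {p *P f Fin.zero} (ΣF-distribˡ p (f ∘ Fin.suc)))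

  ΣF-neg : ∀ {n} (f : Fin n → Poly) → ΣF (λ k → -P f k) ≋ -P ΣF f
  ΣF-neg {zero}  f = P.refl
  ΣF-neg {suc n} f = P.trans (P.+-congˡ { -P f Fin.zero} (ΣF-neg (f ∘ Fin.suc)))
    (solve 2 (λ a b → :- a :+ :- b := :- (a :+ b)) P.refl (f Fin.zero) (ΣF (f ∘ Fin.suc)))

  *-≡0 : ∀ p {q} → q ≡ 0P → p *P q ≋ 0P
  *-≡0 p ≡.refl = P.zeroʳ p

  ≋0-* : ∀ {p} q → p ≋ 0P → p *P q ≋ 0P
  ≋0-* q p≋0 = P.trans (P.*-congʳ {q} p≋0) (P.zeroˡ q)

  constP-0 : constP 0# ≋ 0P
  constP-0 = mk (coeffₜ-zero (replicate _ 0))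

  constP-cong : ∀ {a b} → a ≈ b → constP a ≋ constP b
  constP-cong a≈b = mk (λ m → coeffₜ-cong (replicate _ 0) m a≈b)

  constP-* : ∀ a b → constP (a * b) ≋ constP a *P constP b
  constP-* a b = ≡⇒≋ (≡.cong (λ e → (a * b , e) ∷ []) (≡.sym (⊕-identityˡ (replicate _ 0))))

  constP-− : ∀ a b → constP (a - b) ≋ constP a -P constP b
  constP-− a b = mk (λ m → trans (coeffₜ-+ a (- b) (replicate _ 0) m)
                                 (sym (coeff-cons (a , replicate _ 0) ((- b , replicate _ 0) ∷ []) m)))

  apply-cong : ∀ η η' α → (∀ i → η i ≋ η' i) → apply η α ≋ apply η' α
  apply-cong η η' α η≋η' = ΣF-cong _ _ (λ j → P.*-congˡ {constP (α j)} (η≋η' j))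

  apply-− : ∀ η α β → apply η (λ k → α k - β k) ≋ apply η α -P apply η β
  apply-− η α β = P.trans
    (ΣF-cong _ _ (λ k → P.trans (P.*-congʳ {η k} (constP-− (α k) (β k)))
      (solve 3 (λ a b x → (a :- b) :* x := a :* x :+ :- (b :* x)) P.refl (constP (α k)) (constP (β k)) (η k))))
    (P.trans (ΣF-+ (λ k → constP (α k) *P η k) (λ k → -P (constP (β k) *P η k)))
             (P.+-congˡ {apply η α} (ΣF-neg (λ k → constP (β k) *P η k))))

  apply-scale : ∀ η a α → apply η (λ k → a * α k) ≋ constP a *P apply η α
  apply-scale η a α = P.trans
    (ΣF-cong _ _ (λ k → P.trans (P.*-congʳ {η k} (constP-* a (α k))) (P.*-assoc (constP a) (constP (α k)) (η k))))
    (P.sym (ΣF-distribˡ (constP a) (λ k → constP (α k) *P η k)))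

  apply-e : ∀ η j → apply η (e (toℕ j)) ≋ η j
  apply-e η j = P.trans (ΣF-single (λ k → constP (e (toℕ j) k) *P η k) j vanish)
    (P.trans (P.*-congʳ {η j} (≡⇒≋ (≡.cong constP (if-true (ℕ.≡⇒≡ᵇ (toℕ j) (toℕ j) ≡.refl)))))
             (P.*-identityˡ (η j)))
    where
    vanish : ∀ k → k ≢ j → constP (e (toℕ j) k) *P η k ≋ 0P
    vanish k k≢j = P.trans
      (P.*-congʳ {η k} (P.trans (≡⇒≋ (≡.cong constP (if-false (k≢j ∘ Fin.toℕ-injective ∘ ℕ.≡ᵇ⇒≡ (toℕ k) (toℕ j))))) constP-0))
      (P.zeroˡ (η k))

  apply-−-* : ∀ η η' g α → apply (λ i → η i -P g *P η' i) α ≋ apply η α -P g *P apply η' α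
  apply-−-* η η' g α = begin
    ΣF (λ j → constP (α j) *P (η j -P g *P η' j))
      ≈⟨ ΣF-cong _ _ (λ j → solve 4 (λ c a g b → c :* (a :- g :* b) := c :* a :+ :- (g :* (c :* b)))
                                     P.refl (constP (α j)) (η j) g (η' j)) ⟩
    ΣF (λ j → constP (α j) *P η j +P -P (g *P (constP (α j) *P η' j)))
      ≈⟨ ΣF-+ (λ j → constP (α j) *P η j) (λ j → -P (g *P (constP (α j) *P η' j))) ⟩
    apply η α +P ΣF (λ j → -P (g *P (constP (α j) *P η' j)))
      ≈⟨ P.+-congˡ {apply η α} (P.trans (ΣF-neg (λ j → g *P (constP (α j) *P η' j)))
                                        (P.-‿cong (P.sym (ΣF-distribˡ g (λ j → constP (α j) *P η' j))))) ⟩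
    apply η α -P g *P apply η' α
      ∎
    where open ≋-Reasoning

  ∣-0 : ∀ a → a ∣ 0P
  ∣-0 a = divides 0P (P.sym (P.zeroʳ a))

  ∣-refl : ∀ a → a ∣ a
  ∣-refl a = divides 1P (P.sym (P.*-identityʳ a))

  ∣-*ʳ : ∀ {a b} c → a ∣ b → a ∣ b *P c
  ∣-*ʳ {a} c (divides q eq) = divides (q *P c) (P.trans (P.*-congʳ {c} eq) (P.*-assoc a q c))

  ∣-*ˡ : ∀ {a b} c → a ∣ b → a ∣ c *P b
  ∣-*ˡ {b = b} c a∣b = ∣-respʳ (∣-*ʳ c a∣b) (P.*-comm b c)

  ∣-neg : ∀ {a b} → a ∣ b → a ∣ -P b
  ∣-neg {a} (divides q eq) = divides (-P q) (P.trans (P.-‿cong eq) (solve 2 (λ a q → :- (a :* q) := a :* (:- q)) P.refl a q))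

  ∣-+ : ∀ {a b b'} → a ∣ b → a ∣ b' → a ∣ b +P b'
  ∣-+ {a} (divides q eq) (divides q' eq') = divides (q +P q') (P.trans (P.+-cong eq eq') (P.sym (P.distribˡ a q q')))

  ∣-− : ∀ {a b b'} → a ∣ b → a ∣ b' → a ∣ b -P b'
  ∣-− a∣b a∣b' = ∣-+ a∣b (∣-neg a∣b')

  ∣-ΠL : ∀ {ps p} → p ∈ ps → p ∣ ΠL ps
  ∣-ΠL {p ∷ ps} (here ≡.refl) = divides (ΠL ps) P.refl
  ∣-ΠL {q ∷ ps} (there p∈ps) = ∣-*ˡ q (∣-ΠL p∈ps)

  ΠL-++ : ∀ ps qs → ΠL (ps ++ qs) ≋ ΠL ps *P ΠL qs
  ΠL-++ []       qs = P.sym (P.*-identityˡ (ΠL qs))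
  ΠL-++ (p ∷ ps) qs = P.trans (P.*-congˡ {p} (ΠL-++ ps qs)) (P.sym (P.*-assoc p (ΠL ps) (ΠL qs)))

  ΠL-map-cong : ∀ {a} {A : Set a} (xs : List A) f g → (∀ x → x ∈ xs → f x ≋ g x) → ΠL (map f xs) ≋ ΠL (map g xs)
  ΠL-map-cong []       f g f≋g = P.refl
  ΠL-map-cong (x ∷ xs) f g f≋g = P.*-cong (f≋g x (here ≡.refl)) (ΠL-map-cong xs f g (λ y y∈xs → f≋g y (there y∈xs)))

  infix 4 _∈D′_
  _∈D′_ : Der → List LinForm → Set (c ⊔ r)
  η ∈D′ 𝓐 = All (λ α → L α ∣ apply η α) 𝓐

  ∈D′⇒∈D : ∀ η 𝓐 → η ∈D′ 𝓐 → η ∈D 𝓐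
  ∈D′⇒∈D η 𝓐 = All.map (λ (divides q eq) → q , get eq)

  ∈D⇒∈D′ : ∀ η 𝓐 → η ∈D 𝓐 → η ∈D′ 𝓐
  ∈D⇒∈D′ η 𝓐 = All.map (λ (q , eq) → divides q (mk eq))

  ∈D′-−-* : ∀ η η' g 𝓐 → η ∈D′ 𝓐 → η' ∈D′ 𝓐 → (λ i → η i -P g *P η' i) ∈D′ 𝓐
  ∈D′-−-* η η' g [] [] [] = []
  ∈D′-−-* η η' g (α ∷ 𝓐) (d ∷ ds) (d' ∷ ds') =
    ∣-respʳ (∣-− d (∣-*ˡ g d')) (P.sym (apply-−-* η η' g α)) ∷ ∈D′-−-* η η' g 𝓐 ds ds'

  single : Fin (suc ℓ) → Poly → Fin (suc ℓ) → Poly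
  single j g k with k Fin.≟ j
  ... | yes _ = g
  ... | no _  = 0P

  single-≡ : ∀ j g → single j g j ≡ g
  single-≡ j g with j Fin.≟ j
  ... | yes _  = ≡.refl
  ... | no j≢j = ⊥-elim (j≢j ≡.refl)

  single-≢ : ∀ j g k → k ≢ j → single j g k ≡ 0P
  single-≢ j g k k≢j with k Fin.≟ j
  ... | yes k≡j = ⊥-elim (k≢j k≡j)
  ... | no _    = ≡.refl

  comb-+ : ∀ f g i → comb (λ k → f k +P g k) i ≋ comb f i +P comb g i
  comb-+ f g i = P.trans (ΣF-cong _ _ (λ k → P.distribʳ (θ (toℕ k) i) (f k) (g k)))
    (ΣF-+ (λ k → f k *P θ (toℕ k) i) (λ k → g k *P θ (toℕ k) i))

  comb-single : ∀ j g i → comb (single j g) i ≋ g *P θ (toℕ j) i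
  comb-single j g i = P.trans
    (ΣF-single (λ k → single j g k *P θ (toℕ k) i) j
      (λ k k≢j → P.trans (P.*-congʳ {θ (toℕ k) i} (≡⇒≋ (single-≢ j g k k≢j))) (P.zeroˡ (θ (toℕ k) i))))
    (P.*-congʳ {θ (toℕ j) i} (≡⇒≋ (single-≡ j g)))

  comb-0 : ∀ i → comb (λ _ → 0P) i ≋ 0P
  comb-0 i = ΣF-zero (λ (k : Fin (suc ℓ)) → 0P *P θ (toℕ k) i) (λ k → P.zeroˡ (θ (toℕ k) i))

module Hyperplanes {c r} (F : Field c r) (ℓ : ℕ) (N : ℕ → List (Field.Carrier F)) (2≤ℓ : 2 ≤ ℓ) where
  open Field F
  open Arr F ℓ N
  open PolynomialRing F ℓ N
  open LinearFactors F ℓ N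
  open Derivations F ℓ N
  open FormalDifferenceSolver polynomialRing using (solve; _:+_; _:*_; _:-_; _:=_)

  index : ∀ i → i ≤ ℓ → Var
  index i i≤ℓ = Fin.fromℕ< (s≤s i≤ℓ)

  toℕ-index : ∀ i i≤ℓ → toℕ (index i i≤ℓ) ≡ i
  toℕ-index i i≤ℓ = Fin.toℕ-fromℕ< (s≤s i≤ℓ)

  toℕ≤ℓ : ∀ (j : Var) → toℕ j ≤ ℓ
  toℕ≤ℓ j = ℕ.≤-pred (Fin.toℕ<n j)

  X-index : ∀ i i≤ℓ → X (toℕ (index i i≤ℓ)) ≋ X i
  X-index i i≤ℓ = ≡⇒≋ (≡.cong X (toℕ-index i i≤ℓ))

  1≤ℓ : 1 ≤ ℓ
  1≤ℓ = ℕ.≤-trans (s≤s z≤n) 2≤ℓ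

  z-var x₁-var : Var
  z-var  = Fin.zero
  x₁-var = index 1 1≤ℓ

  toℕ-x₁-var : toℕ x₁-var ≡ 1
  toℕ-x₁-var = toℕ-index 1 1≤ℓ

  x₁-var≢0 : toℕ x₁-var ≢ 0
  x₁-var≢0 eq with ≡.trans (≡.sym toℕ-x₁-var) eq
  ... | ()

  var-cases : ∀ (j : Var) → j ≡ z-var ⊎ j ≡ x₁-var ⊎ 2 ≤ toℕ j
  var-cases j with toℕ j in eq
  ... | zero        = inj₁ (Fin.toℕ-injective eq)
  ... | suc zero    = inj₂ (inj₁ (Fin.toℕ-injective (≡.trans eq (≡.sym toℕ-x₁-var))))
  ... | suc (suc _) = inj₂ (inj₂ (s≤s (s≤s z≤n)))

  apply-e-index : ∀ η i i≤ℓ → apply η (e i) ≋ η (index i i≤ℓ)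
  apply-e-index η i i≤ℓ = ≡.subst (λ j → apply η (e j) ≋ η (index i i≤ℓ)) (toℕ-index i i≤ℓ) (apply-e η (index i i≤ℓ))

  apply-hypA : ∀ η j a (j≤ℓ : j ≤ ℓ) → apply η (hypA j a) ≋ η x₁-var -P η (index j j≤ℓ) -P constP a *P η z-var
  apply-hypA η j a j≤ℓ = P.trans (apply-− η (λ k → e 1 k - e j k) (λ k → a * e 0 k))
    (P.+-cong (P.trans (apply-− η (e 1) (e j)) (P.+-cong (apply-e-index η 1 1≤ℓ) (P.-‿cong (apply-e-index η j j≤ℓ))))
              (P.-‿cong (P.trans (apply-scale η a (e 0)) (P.*-congˡ {constP a} (apply-e η z-var)))))

  apply-hypB : ∀ η i j (i≤ℓ : i ≤ ℓ) (j≤ℓ : j ≤ ℓ) → apply η (hypB i j) ≋ η (index i i≤ℓ) -P η (index j j≤ℓ)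
  apply-hypB η i j i≤ℓ j≤ℓ = P.trans (apply-− η (e i) (e j)) (P.+-cong (apply-e-index η i i≤ℓ) (P.-‿cong (apply-e-index η j j≤ℓ)))

  A-factor : ℕ → Carrier → Poly
  A-factor s a = x 1 -P x s -P constP a *P z

  B-factor : ℕ → ℕ → Poly
  B-factor s t = x s -P x t

  θ-entry : ℕ → ℕ → Poly
  θ-entry k s = ΠL (map (A-factor s) (N k)) *P ΠL (map (B-factor s) [ suc k ⋯ ℓ ])

  L-e0 : L (e 0) ≋ z
  L-e0 = apply-e (λ j → X (toℕ j)) z-var

  L-hypA : ∀ j a → j ≤ ℓ → L (hypA j a) ≋ A-factor j a
  L-hypA j a j≤ℓ = P.trans (apply-hypA (λ j → X (toℕ j)) j a j≤ℓ)
    (P.+-congʳ { -P (constP a *P z)} (P.+-cong (X-index 1 1≤ℓ) (P.-‿cong (X-index j j≤ℓ))))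

  L-hypB : ∀ i j → i ≤ ℓ → j ≤ ℓ → L (hypB i j) ≋ B-factor i j
  L-hypB i j i≤ℓ j≤ℓ = P.trans (apply-hypB (λ j → X (toℕ j)) i j i≤ℓ j≤ℓ) (P.+-cong (X-index i i≤ℓ) (P.-‿cong (X-index j j≤ℓ)))

  θ₀-≢0 : ∀ (j : Var) → toℕ j ≢ 0 → θ 0 j ≡ 1P
  θ₀-≢0 j j≢0 = if-false (j≢0 ∘ ℕ.≡ᵇ⇒≡ (toℕ j) 0)

  θ-inside : ∀ k (j : Var) → 2 ≤ k → 2 ≤ toℕ j → toℕ j ≤ k → θ k j ≡ θ-entry k (toℕ j)
  θ-inside (suc zero) j (s≤s ()) _ _
  θ-inside (suc (suc m)) j _ 2≤j j≤k =
    if-true {b = (2 ≤ᵇ toℕ j) ∧ (toℕ j ≤ᵇ suc (suc m))} (Equivalence.from Bool.T-∧ (ℕ.≤⇒≤ᵇ 2≤j , ℕ.≤⇒≤ᵇ j≤k))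

  θ-outside : ∀ k (j : Var) → 2 ≤ k → toℕ j < 2 ⊎ k < toℕ j → θ k j ≡ 0P
  θ-outside (suc zero) j (s≤s ()) _
  θ-outside (suc (suc m)) j _ (inj₁ j<2) =
    if-false {b = (2 ≤ᵇ toℕ j) ∧ (toℕ j ≤ᵇ suc (suc m))} (λ t → ℕ.<⇒≱ j<2 (ℕ.≤ᵇ⇒≤ 2 (toℕ j) (proj₁ (Equivalence.to Bool.T-∧ t))))
  θ-outside (suc (suc m)) j _ (inj₂ k<j) =
    if-false {b = (2 ≤ᵇ toℕ j) ∧ (toℕ j ≤ᵇ suc (suc m))} (λ t → ℕ.<⇒≱ k<j (ℕ.≤ᵇ⇒≤ (toℕ j) _ (proj₂ (Equivalence.to Bool.T-∧ t))))

  θ-inside-index : ∀ k s s≤ℓ → 2 ≤ k → 2 ≤ s → s ≤ k → θ k (index s s≤ℓ) ≡ θ-entry k s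
  θ-inside-index k s s≤ℓ 2≤k 2≤s s≤k = ≡.trans
    (θ-inside k (index s s≤ℓ) 2≤k (≡.subst (2 ≤_) (≡.sym eq) 2≤s) (≡.subst (_≤ k) (≡.sym eq) s≤k))
    (≡.cong (θ-entry k) eq)
    where
    eq : toℕ (index s s≤ℓ) ≡ s
    eq = toℕ-index s s≤ℓ

  θ₁-at-z : θ (toℕ x₁-var) z-var ≡ z
  θ₁-at-z = ≡.cong (λ n → θ n z-var) toℕ-x₁-var

  θ₀-at-x₁ : θ (toℕ z-var) x₁-var ≡ 1P
  θ₀-at-x₁ = θ₀-≢0 x₁-var x₁-var≢0

  θ-z : ∀ k → 2 ≤ k → θ k z-var ≡ 0P
  θ-z k 2≤k = θ-outside k z-var 2≤k (inj₁ (s≤s z≤n))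

  θ-x₁ : ∀ k → 2 ≤ k → θ k x₁-var ≡ 0P
  θ-x₁ k 2≤k = θ-outside k x₁-var 2≤k (inj₁ (≡.subst (_< 2) (≡.sym toℕ-x₁-var) (s≤s (s≤s z≤n))))

module Factorisation {c r} (F : Field c r) (ℓ : ℕ) (N : ℕ → List (Field.Carrier F)) (2≤ℓ : 2 ≤ ℓ) where
  open Field F
  open Arr F ℓ N
  open PolynomialRing F ℓ N
  open LinearFactors F ℓ N
  open Derivations F ℓ N
  open Hyperplanes F ℓ N 2≤ℓ
  open Ranges
  open FormalDifferenceSolver polynomialRing using (solve; _:+_; _:*_; _:-_; _:=_)
  open import Algebra.Properties.Ring ring using (x∙y⁻¹≈ε⇒x≈y)

  X-free : ∀ i (w : Var) → toℕ w ≢ i → FreeOf w (X i)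
  X-free i w w≢i = ℕ.≤-reflexive (exponent-δ-≢ i w w≢i) ∷ []

  X-X-free : ∀ i j (w : Var) → toℕ w ≢ i → toℕ w ≢ j → FreeOf w (X i -P X j)
  X-X-free i j w w≢i w≢j = All.++⁺ (X-free i w w≢i) (DegreeAtMost-neg (X j) (X-free j w w≢j))

  constP-z-free : ∀ a (w : Var) → toℕ w ≢ 0 → FreeOf w (constP a *P z)
  constP-z-free a w w≢0 = DegreeAtMost-*P (constP a) z (ℕ.≤-reflexive (Vec.lookup-replicate w 0) ∷ []) (X-free 0 w w≢0)

  x₁-var≢ : ∀ s → 2 ≤ s → toℕ x₁-var ≢ s
  x₁-var≢ s 2≤s eq = ℕ.<⇒≢ (≡.subst (_< s) (≡.sym toℕ-x₁-var) 2≤s) eq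

  index≢ : ∀ {s t} s≤ℓ → t ≢ s → toℕ (index s s≤ℓ) ≢ t
  index≢ s≤ℓ t≢s eq = t≢s (≡.trans (≡.sym eq) (toℕ-index _ s≤ℓ))

  A-linear : ∀ s → 2 ≤ s → Carrier → LinearFactor
  A-linear s 2≤s a = record
    { var = x₁-var ; rest = X s +P constP a *P z
    ; rest-free = All.++⁺ (X-free s x₁-var (x₁-var≢ s 2≤s)) (constP-z-free a x₁-var x₁-var≢0) }

  A-linear-toPoly : ∀ s 2≤s a → toPoly (A-linear s 2≤s a) ≋ A-factor s a
  A-linear-toPoly s 2≤s a = P.trans (P.+-congʳ { -P (X s +P constP a *P z)} (X-index 1 1≤ℓ))
    (solve 3 (λ p q w → p :- (q :+ w) := p :- q :- w) P.refl (X 1) (X s) (constP a *P z))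

  -- Only t ≠ s occurs below (t ranges over [ k+1 ⋯ ℓ ] with s = k); the case t = s gets a dummy.
  B-linear : ∀ s → s ≤ ℓ → ℕ → LinearFactor
  B-linear s s≤ℓ t with t ℕ.≟ s
  ... | yes _   = record { var = index s s≤ℓ ; rest = [] ; rest-free = [] }
  ... | no t≢s  = record { var = index s s≤ℓ ; rest = X t ; rest-free = X-free t (index s s≤ℓ) (index≢ s≤ℓ t≢s) }

  B-linear-toPoly≡ : ∀ s s≤ℓ t → t ≢ s → toPoly (B-linear s s≤ℓ t) ≡ X (toℕ (index s s≤ℓ)) -P X t
  B-linear-toPoly≡ s s≤ℓ t t≢s with t ℕ.≟ s
  ... | yes t≡s = ⊥-elim (t≢s t≡s)
  ... | no _    = ≡.refl

  B-linear-toPoly : ∀ s s≤ℓ t → t ≢ s → toPoly (B-linear s s≤ℓ t) ≋ B-factor s t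
  B-linear-toPoly s s≤ℓ t t≢s = P.trans (≡⇒≋ (B-linear-toPoly≡ s s≤ℓ t t≢s)) (P.+-congʳ { -P X t} (X-index s s≤ℓ))

  X-X-cancelˡ : ∀ i j → i ≤ ℓ → j ≢ i → ∀ q → (X i -P X j) *P q ≋ 0P → q ≋ 0P
  X-X-cancelˡ i j i≤ℓ j≢i q eq = linear-cancelˡ (index i i≤ℓ) (X j) (X-free j (index i i≤ℓ) (index≢ i≤ℓ j≢i)) q
    (P.trans (P.*-congʳ {q} (P.+-congʳ { -P X j} (X-index i i≤ℓ))) eq)

  A-A-coprime : ∀ s 2≤s a b → ¬ (a ≈ b) → Coprime (A-linear s 2≤s a) (A-linear s 2≤s b)
  A-A-coprime s 2≤s a b a≉b = record
    { factor = 1P ; residue = constP (a - b) *P z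
    ; residue-free = constP-z-free (a - b) x₁-var x₁-var≢0
    ; residue-cancel = λ q eq → linear-cancelˡ z-var [] [] q
        (constP-cancelˡ (a - b) (a≉b ∘ x∙y⁻¹≈ε⇒x≈y a b) (z *P q) (P.trans (P.sym (P.*-assoc (constP (a - b)) z q)) eq))
    ; decomposition = P.trans
        (solve 5 (λ p q w ca cb → p :- (q :+ cb :* w) := (p :- (q :+ ca :* w)) :+ (ca :- cb) :* w)
               P.refl (X (toℕ x₁-var)) (X s) z (constP a) (constP b))
        (P.+-cong (P.sym (P.*-identityˡ (X (toℕ x₁-var) -P (X s +P constP a *P z)))) (P.*-congʳ {z} (P.sym (constP-− a b))))
    }

  A-B-coprime : ∀ s 2≤s s≤ℓ a t → t ≢ s → t ≢ 1 → Coprime (A-linear s 2≤s a) (B-linear s s≤ℓ t)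
  A-B-coprime s 2≤s s≤ℓ a t t≢s t≢1 = record
    { factor = 0P ; residue = X (toℕ (index s s≤ℓ)) -P X t
    ; residue-free = X-X-free (toℕ (index s s≤ℓ)) t x₁-var
        (λ eq → x₁-var≢ s 2≤s (≡.trans eq (toℕ-index s s≤ℓ))) (λ eq → t≢1 (≡.trans (≡.sym eq) toℕ-x₁-var))
    ; residue-cancel = λ q → linear-cancelˡ (index s s≤ℓ) (X t) (X-free t (index s s≤ℓ) (index≢ s≤ℓ t≢s)) q
    ; decomposition = P.trans (≡⇒≋ (B-linear-toPoly≡ s s≤ℓ t t≢s))
        (P.sym (P.trans (P.+-congʳ {X (toℕ (index s s≤ℓ)) -P X t} (P.zeroˡ (X (toℕ x₁-var) -P (X s +P constP a *P z))))
                        (P.+-identityˡ (X (toℕ (index s s≤ℓ)) -P X t))))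
    }

  B-B-coprime : ∀ s s≤ℓ t t' → t ≢ s → t' ≢ s → t' ≢ t → t ≤ ℓ → Coprime (B-linear s s≤ℓ t) (B-linear s s≤ℓ t')
  B-B-coprime s s≤ℓ t t' t≢s t'≢s t'≢t t≤ℓ with t ℕ.≟ s | t' ℕ.≟ s
  ... | yes t≡s | _        = ⊥-elim (t≢s t≡s)
  ... | no _    | yes t'≡s = ⊥-elim (t'≢s t'≡s)
  ... | no _    | no _     = record
    { factor = 1P ; residue = X t -P X t'
    ; residue-free = X-X-free t t' (index s s≤ℓ) (index≢ s≤ℓ t≢s) (index≢ s≤ℓ t'≢s)
    ; residue-cancel = X-X-cancelˡ t t' t≤ℓ t'≢t
    ; decomposition = P.trans
        (solve 3 (λ p q w → p :- w := (p :- q) :+ (q :- w)) P.refl (X (toℕ (index s s≤ℓ))) (X t) (X t'))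
        (P.+-congʳ {X t -P X t'} (P.sym (P.*-identityˡ (X (toℕ (index s s≤ℓ)) -P X t))))
    }

  factors : ∀ k → 2 ≤ k → k ≤ ℓ → List LinearFactor
  factors k 2≤k k≤ℓ = map (A-linear k 2≤k) (N k) ++ map (B-linear k k≤ℓ) [ suc k ⋯ ℓ ]

  factors-coprime : FiniteSets F ℓ N → ∀ k 2≤k k≤ℓ → AllPairs Coprime (factors k 2≤k k≤ℓ)
  factors-coprime finite k 2≤k k≤ℓ = AllPairs.++⁺
    (AllPairs.map⁺ (AllPairs.map (A-A-coprime k 2≤k _ _) (finite k 2≤k k≤ℓ)))
    (AllPairs.map⁺ (AllPairs.map (λ (t'≢t , (k<t , t≤ℓ) , (k<t' , _)) →
        B-B-coprime k k≤ℓ _ _ (>⇒≢ k<t) (>⇒≢ k<t') (t'≢t ∘ ≡.sym) t≤ℓ)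
      (all-pairs-in-range [ suc k ⋯ ℓ ] (⋯-distinct (suc k) ℓ) (All.tabulate ∈-⋯⁻))))
    (All.map⁺ (All.tabulate (λ {a} _ → All.map⁺ (All.tabulate (λ {t} t∈ → let (k<t , _) = ∈-⋯⁻ t∈ in
        A-B-coprime k 2≤k k≤ℓ a t (>⇒≢ k<t) (>⇒≢ (ℕ.≤-trans 2≤k (ℕ.<⇒≤ k<t))))))))
    where
    >⇒≢ : ∀ {m n} → m < n → n ≢ m
    >⇒≢ m<n n≡m = ℕ.<⇒≢ m<n (≡.sym n≡m)
    all-pairs-in-range : ∀ {a p q} {A : Set a} {R : A → A → Set p} {Q : A → Set q} xs → AllPairs R xs → All Q xs →
      AllPairs (λ x y → R x y × Q x × Q y) xs
    all-pairs-in-range [] [] [] = []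
    all-pairs-in-range (x ∷ xs) (Rx ∷ Rxs) (Qx ∷ Qxs) =
      All.zipWith (λ (Rxy , Qy) → Rxy , Qx , Qy) (Rx , Qxs) ∷ all-pairs-in-range xs Rxs Qxs

  ΠF-factors : ∀ k 2≤k k≤ℓ → ΠF (factors k 2≤k k≤ℓ) ≋ θ-entry k k
  ΠF-factors k 2≤k k≤ℓ = begin
    ΠL (map toPoly (As ++ Bs))                       ≈⟨ ≡⇒≋ (≡.cong ΠL (List.map-++ toPoly As Bs)) ⟩
    ΠL (map toPoly As ++ map toPoly Bs)              ≈⟨ ΠL-++ (map toPoly As) (map toPoly Bs) ⟩
    ΠL (map toPoly As) *P ΠL (map toPoly Bs)
      ≈⟨ P.*-cong (P.trans (≡⇒≋ (≡.cong ΠL (≡.sym (List.map-∘ (N k)))))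
                           (ΠL-map-cong (N k) _ (A-factor k) (λ a _ → A-linear-toPoly k 2≤k a)))
                  (P.trans (≡⇒≋ (≡.cong ΠL (≡.sym (List.map-∘ [ suc k ⋯ ℓ ]))))
                           (ΠL-map-cong [ suc k ⋯ ℓ ] _ (B-factor k)
                              (λ t t∈ → B-linear-toPoly k k≤ℓ t (λ t≡k → ℕ.<⇒≢ (proj₁ (∈-⋯⁻ t∈)) (≡.sym t≡k))))) ⟩
    θ-entry k k                                      ∎
    where
    open ≋-Reasoning
    As Bs : List LinearFactor
    As = map (A-linear k 2≤k) (N k)
    Bs = map (B-linear k k≤ℓ) [ suc k ⋯ ℓ ]

module Membership {c r} (F : Field c r) (ℓ : ℕ) (N : ℕ → List (Field.Carrier F)) (2≤ℓ : 2 ≤ ℓ) where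
  open Field F
  open Arr F ℓ N
  open PolynomialRing F ℓ N
  open LinearFactors F ℓ N
  open Derivations F ℓ N
  open Hyperplanes F ℓ N 2≤ℓ
  open Ranges
  open FormalDifferenceSolver polynomialRing using (solve; con; _:+_; _:*_; _:-_; :-_; _:=_)

  <⇒≤∸1 : ∀ {i j} → i < j → i ≤ j ℕ.∸ 1
  <⇒≤∸1 (s≤s i≤j) = i≤j

  hypA∈𝓘N : ∀ {j a} → 2 ≤ j → j ≤ ℓ → a ∈ N j → hypA j a ∈ 𝓘N
  hypA∈𝓘N 2≤j j≤ℓ a∈ = there (List.∈-++⁺ˡ (List.∈-concatMap⁺ (λ j → map (hypA j) (N j))
    (Any.map (λ { ≡.refl → List.∈-map⁺ (hypA _) a∈ }) (∈-⋯⁺ 2≤j j≤ℓ))))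

  hypB∈𝓘N : ∀ {i j} → 2 ≤ i → i < j → j ≤ ℓ → hypB i j ∈ 𝓘N
  hypB∈𝓘N 2≤i i<j j≤ℓ = there (List.∈-++⁺ʳ _ (List.∈-concatMap⁺ (λ j → map (λ i → hypB i j) [ 2 ⋯ j ℕ.∸ 1 ])
    (Any.map (λ { ≡.refl → List.∈-map⁺ (λ i → hypB i _) (∈-⋯⁺ 2≤i (<⇒≤∸1 i<j)) })
             (∈-⋯⁺ (ℕ.≤-trans 2≤i (ℕ.<⇒≤ i<j)) j≤ℓ))))

  ∈D′-intro : ∀ η → L (e 0) ∣ apply η (e 0) →
    (∀ j a → 2 ≤ j → j ≤ ℓ → a ∈ N j → L (hypA j a) ∣ apply η (hypA j a)) →
    (∀ i j → 2 ≤ i → i < j → j ≤ ℓ → L (hypB i j) ∣ apply η (hypB i j)) →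
    η ∈D′ 𝓘N
  ∈D′-intro η d-z d-A d-B = d-z ∷ All.++⁺
    (All.concat⁺ (All.map⁺ (All.tabulate λ j∈ → let (2≤j , j≤ℓ) = ∈-⋯⁻ j∈ in
      All.map⁺ (All.tabulate λ a∈ → d-A _ _ 2≤j j≤ℓ a∈))))
    (All.concat⁺ (All.map⁺ {f = λ j → map (λ i → hypB i j) [ 2 ⋯ j ℕ.∸ 1 ]} (All.tabulate {xs = [ 2 ⋯ ℓ ]} λ {j} j∈ → let (_ , j≤ℓ) = ∈-⋯⁻ j∈ in
      All.map⁺ {f = λ i → hypB i j} (All.tabulate λ i∈ → let (2≤i , i≤j-1) = ∈-⋯⁻ i∈ in
        d-B _ _ 2≤i (≤∸1⇒< (ℕ.≤-trans (s≤s z≤n) 2≤i) i≤j-1) j≤ℓ))))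
    where
    ≤∸1⇒< : ∀ {i j} → 1 ≤ i → i ≤ j ℕ.∸ 1 → i < j
    ≤∸1⇒< {j = zero}  1≤i i≤0 = ⊥-elim (ℕ.<⇒≱ 1≤i i≤0)
    ≤∸1⇒< {j = suc j} _   i≤j = s≤s i≤j

  apply-hypA-∣ : ∀ η j a (j≤ℓ : j ≤ ℓ) → L (hypA j a) ∣ η x₁-var -P η (index j j≤ℓ) -P constP a *P η z-var →
    L (hypA j a) ∣ apply η (hypA j a)
  apply-hypA-∣ η j a j≤ℓ d = ∣-respʳ d (P.sym (apply-hypA η j a j≤ℓ))

  apply-hypB-∣ : ∀ η i j (i≤ℓ : i ≤ ℓ) (j≤ℓ : j ≤ ℓ) → L (hypB i j) ∣ η (index i i≤ℓ) -P η (index j j≤ℓ) →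
    L (hypB i j) ∣ apply η (hypB i j)
  apply-hypB-∣ η i j i≤ℓ j≤ℓ d = ∣-respʳ d (P.sym (apply-hypB η i j i≤ℓ j≤ℓ))

  apply-e0-∣ : ∀ η → L (e 0) ∣ η z-var → L (e 0) ∣ apply η (e 0)
  apply-e0-∣ η d = ∣-respʳ d (P.sym (apply-e η z-var))

  θ₀-index : ∀ i i≤ℓ → 1 ≤ i → θ 0 (index i i≤ℓ) ≡ 1P
  θ₀-index i i≤ℓ 1≤i = θ₀-≢0 (index i i≤ℓ) (λ eq → ℕ.<⇒≢ 1≤i (≡.sym (≡.trans (≡.sym (toℕ-index i i≤ℓ)) eq)))

  θ₀∈D : θ 0 ∈D′ 𝓘N
  θ₀∈D = ∈D′-intro (θ 0) (apply-e0-∣ (θ 0) (∣-0 _))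
    (λ j a 2≤j j≤ℓ _ → apply-hypA-∣ (θ 0) j a j≤ℓ (∣-respʳ (∣-0 _) (P.sym (begin
      θ 0 x₁-var -P θ 0 (index j j≤ℓ) -P constP a *P 0P
        ≈⟨ ≡⇒≋ (≡.cong₂ (λ u v → u -P v -P constP a *P 0P) (θ₀-index 1 1≤ℓ (s≤s z≤n)) (θ₀-index j j≤ℓ (ℕ.≤-trans (s≤s z≤n) 2≤j))) ⟩
      1P -P 1P -P constP a *P 0P
        ≈⟨ solve 2 (λ o c → o :- o :- c :* con (0 , 0) := con (0 , 0)) P.refl 1P (constP a) ⟩
      0P ∎))))
    (λ i j 2≤i i<j j≤ℓ → let i≤ℓ = ℕ.≤-trans (ℕ.<⇒≤ i<j) j≤ℓ in
      apply-hypB-∣ (θ 0) i j i≤ℓ j≤ℓ (∣-respʳ (∣-0 _) (P.sym (P.trans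
        (≡⇒≋ (≡.cong₂ _-P_ (θ₀-index i i≤ℓ (ℕ.≤-trans (s≤s z≤n) 2≤i)) (θ₀-index j j≤ℓ (ℕ.≤-trans (s≤s z≤n) (ℕ.≤-trans 2≤i (ℕ.<⇒≤ i<j))))))
        (P.-‿inverseʳ 1P)))))
    where open ≋-Reasoning

  θ₁∈D : θ 1 ∈D′ 𝓘N
  θ₁∈D = ∈D′-intro (θ 1) (∣-refl _) (λ j a _ _ _ → ∣-refl _) (λ i j _ _ _ → ∣-refl _)

  nested-≤′ : Nested F ℓ N → ∀ {j k a} → 2 ≤ j → j ℕ.≤′ k → k ≤ ℓ → _∈K_ F a (N j) → _∈K_ F a (N k)
  nested-≤′ nested 2≤j ℕ.≤′-refl k≤ℓ a∈ = a∈
  nested-≤′ nested {j} {suc k} 2≤j (ℕ.≤′-step j≤′k) k<ℓ a∈ =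
    nested k (ℕ.≤-trans 2≤j (ℕ.≤′⇒≤ j≤′k)) k<ℓ _ (nested-≤′ nested 2≤j j≤′k (ℕ.<⇒≤ k<ℓ) a∈)

  A-factor-cong : ∀ s {a a'} → a ≈ a' → A-factor s a ≋ A-factor s a'
  A-factor-cong s a≈a' = P.+-congˡ {x 1 -P x s} (P.-‿cong (P.*-congʳ {z} (constP-cong a≈a')))

  -- θ-entry k is a product of factors each of which is congruent modulo x_i - x_j
  -- to its counterpart at j.
  θ-entry-difference : ∀ k i j → X i -P X j ∣ θ-entry k i -P θ-entry k j
  θ-entry-difference k i j = ∣-*-difference
    (ΠL (map (A-factor i) (N k))) (ΠL (map (A-factor j) (N k)))
    (ΠL (map (B-factor i) [ suc k ⋯ ℓ ])) (ΠL (map (B-factor j) [ suc k ⋯ ℓ ]))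
    (ΠL-difference (N k) (λ a s → A-factor s a) (λ a → ∣-respʳ (∣-neg (∣-refl (X i -P X j)))
      (solve 4 (λ p q r w → :- (q :- r) := (p :- q :- w) :- (p :- r :- w)) P.refl (x 1) (X i) (X j) (constP a *P z))))
    (ΠL-difference [ suc k ⋯ ℓ ] (λ t s → B-factor s t) (λ t → ∣-respʳ (∣-refl (X i -P X j))
      (solve 3 (λ p q w → p :- q := (p :- w) :- (q :- w)) P.refl (X i) (X j) (X t))))
    where
    ∣-*-difference : ∀ {d} a a' b b' → d ∣ a -P a' → d ∣ b -P b' → d ∣ a *P b -P a' *P b'
    ∣-*-difference a a' b b' da db = ∣-respʳ (∣-+ (∣-*ˡ a db) (∣-*ʳ b' da))
      (solve 4 (λ a a' b b' → a :* (b :- b') :+ (a :- a') :* b' := a :* b :- a' :* b') P.refl a a' b b')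
    ΠL-difference : ∀ {a} {A : Set a} (ys : List A) (G : A → ℕ → Poly) → (∀ y → X i -P X j ∣ G y i -P G y j) →
      X i -P X j ∣ ΠL (map (λ y → G y i) ys) -P ΠL (map (λ y → G y j) ys)
    ΠL-difference []       G dG = ∣-respʳ (∣-0 _) (P.sym (P.-‿inverseʳ 1P))
    ΠL-difference (y ∷ ys) G dG = ∣-*-difference (G y i) (G y j)
      (ΠL (map (λ y → G y i) ys)) (ΠL (map (λ y → G y j) ys)) (dG y) (ΠL-difference ys G dG)

  θ-entry-A-∣ : Nested F ℓ N → ∀ k j a → 2 ≤ j → j ≤ k → k ≤ ℓ → a ∈ N j → L (hypA j a) ∣ θ-entry k j
  θ-entry-A-∣ nested k j a 2≤j j≤k k≤ℓ a∈ with find (nested-≤′ nested 2≤j (ℕ.≤⇒≤′ j≤k) k≤ℓ (Any.map (λ { ≡.refl → refl }) a∈))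
  ... | a' , a'∈ , a≈a' = ∣-respˡ (∣-*ʳ (ΠL (map (B-factor j) [ suc k ⋯ ℓ ])) (∣-ΠL (List.∈-map⁺ (A-factor j) a'∈)))
                                   (P.sym (P.trans (L-hypA j a (ℕ.≤-trans j≤k k≤ℓ)) (A-factor-cong j a≈a')))

  θ-entry-B-∣ : ∀ k i j → k < j → j ≤ ℓ → i ≤ ℓ → L (hypB i j) ∣ θ-entry k i
  θ-entry-B-∣ k i j k<j j≤ℓ i≤ℓ = ∣-respˡ (∣-*ˡ (ΠL (map (A-factor i) (N k))) (∣-ΠL (List.∈-map⁺ (B-factor i) (∈-⋯⁺ k<j j≤ℓ))))
                                          (P.sym (L-hypB i j i≤ℓ j≤ℓ))

  θ-index : ∀ k s s≤ℓ → 2 ≤ k → 2 ≤ s →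
    θ k (index s s≤ℓ) ≡ θ-entry k s × s ≤ k ⊎ θ k (index s s≤ℓ) ≡ 0P × k < s
  θ-index k s s≤ℓ 2≤k 2≤s with s ℕ.≤? k
  ... | yes s≤k = inj₁ (θ-inside-index k s s≤ℓ 2≤k 2≤s s≤k , s≤k)
  ... | no  s≰k = inj₂ (θ-outside k (index s s≤ℓ) 2≤k (inj₂ (≡.subst (_ <_) (≡.sym (toℕ-index s s≤ℓ)) (ℕ.≰⇒> s≰k))) , ℕ.≰⇒> s≰k)

  θₖ∈D : Nested F ℓ N → ∀ k → 2 ≤ k → k ≤ ℓ → θ k ∈D′ 𝓘N
  θₖ∈D nested k 2≤k k≤ℓ = ∈D′-intro (θ k)
    (apply-e0-∣ (θ k) (≡.subst (_ ∣_) (≡.sym (θ-z k 2≤k)) (∣-0 _))) A-case B-case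
    where
    A-case : ∀ j a → 2 ≤ j → j ≤ ℓ → a ∈ N j → L (hypA j a) ∣ apply (θ k) (hypA j a)
    A-case j a 2≤j j≤ℓ a∈ = apply-hypA-∣ (θ k) j a j≤ℓ
      (≡.subst₂ (λ u v → L (hypA j a) ∣ u -P θ k (index j j≤ℓ) -P constP a *P v) (≡.sym (θ-x₁ k 2≤k)) (≡.sym (θ-z k 2≤k))
        (∣-− (∣-− (∣-0 _) θₖ-x_j-∣) (∣-*ˡ (constP a) (∣-0 _))))
      where
      θₖ-x_j-∣ : L (hypA j a) ∣ θ k (index j j≤ℓ)
      θₖ-x_j-∣ with θ-index k j j≤ℓ 2≤k 2≤j
      ... | inj₁ (eq , j≤k) = ≡.subst (_ ∣_) (≡.sym eq) (θ-entry-A-∣ nested k j a 2≤j j≤k k≤ℓ a∈)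
      ... | inj₂ (eq , _)   = ≡.subst (_ ∣_) (≡.sym eq) (∣-0 _)
    B-case : ∀ i j → 2 ≤ i → i < j → j ≤ ℓ → L (hypB i j) ∣ apply (θ k) (hypB i j)
    B-case i j 2≤i i<j j≤ℓ = apply-hypB-∣ (θ k) i j i≤ℓ j≤ℓ θₖ-difference-∣
      where
      i≤ℓ : i ≤ ℓ
      i≤ℓ = ℕ.≤-trans (ℕ.<⇒≤ i<j) j≤ℓ
      θₖ-difference-∣ : L (hypB i j) ∣ θ k (index i i≤ℓ) -P θ k (index j j≤ℓ)
      θₖ-difference-∣ with θ-index k i i≤ℓ 2≤k 2≤i | θ-index k j j≤ℓ 2≤k (ℕ.≤-trans 2≤i (ℕ.<⇒≤ i<j))
      ... | inj₁ (eqᵢ , _) | inj₁ (eqⱼ , _) = ≡.subst₂ (λ u v → _ ∣ u -P v) (≡.sym eqᵢ) (≡.sym eqⱼ)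
                                    (∣-respˡ (θ-entry-difference k i j) (P.sym (L-hypB i j i≤ℓ j≤ℓ)))
      ... | inj₁ (eqᵢ , _) | inj₂ (eqⱼ , k<j) = ≡.subst₂ (λ u v → _ ∣ u -P v) (≡.sym eqᵢ) (≡.sym eqⱼ)
                                    (∣-− (θ-entry-B-∣ k i j k<j j≤ℓ i≤ℓ) (∣-0 _))
      ... | inj₂ (eqᵢ , _) | inj₂ (eqⱼ , _) = ≡.subst₂ (λ u v → _ ∣ u -P v) (≡.sym eqᵢ) (≡.sym eqⱼ) (∣-− (∣-0 _) (∣-0 _))
      ... | inj₂ (_ , k<i) | inj₁ (_ , j≤k) = ⊥-elim (ℕ.<-asym k<i (ℕ.<-≤-trans i<j j≤k))

  θ∈D : Nested F ℓ N → ∀ (k : Var) → θ (toℕ k) ∈D′ 𝓘N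
  θ∈D nested k with toℕ k | toℕ≤ℓ k
  ... | zero        | _   = θ₀∈D
  ... | suc zero    | _   = θ₁∈D
  ... | suc (suc m) | k≤ℓ = θₖ∈D nested (suc (suc m)) (s≤s (s≤s z≤n)) k≤ℓ

module Independence {c r} (F : Field c r) (ℓ : ℕ) (N : ℕ → List (Field.Carrier F)) (2≤ℓ : 2 ≤ ℓ) where
  open Field F
  open Arr F ℓ N
  open PolynomialRing F ℓ N
  open LinearFactors F ℓ N
  open Derivations F ℓ N
  open Hyperplanes F ℓ N 2≤ℓ
  open Factorisation F ℓ N 2≤ℓ
  open ≋-Reasoning

  θ-at-z : ∀ (k : Var) → k ≢ x₁-var → θ (toℕ k) z-var ≡ 0P
  θ-at-z k k≢x₁ with var-cases k
  ... | inj₁ ≡.refl        = ≡.refl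
  ... | inj₂ (inj₁ k≡x₁)   = ⊥-elim (k≢x₁ k≡x₁)
  ... | inj₂ (inj₂ 2≤k)    = θ-z (toℕ k) 2≤k

  module _ (f : Var → Poly) (comb≋0 : ∀ i → comb f i ≋ 0P) where

    comb-at : ∀ i j → (∀ k → k ≢ j → f k *P θ (toℕ k) i ≋ 0P) → f j *P θ (toℕ j) i ≋ 0P
    comb-at i j others = P.trans (P.sym (ΣF-single (λ k → f k *P θ (toℕ k) i) j others)) (comb≋0 i)

    f-x₁≋0 : f x₁-var ≋ 0P
    f-x₁≋0 = linear-cancelˡ z-var [] [] (f x₁-var) (begin
      z *P f x₁-var                     ≈⟨ P.*-comm z (f x₁-var) ⟩
      f x₁-var *P z                     ≈⟨ P.*-congˡ {f x₁-var} (≡⇒≋ θ₁-at-z) ⟨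
      f x₁-var *P θ (toℕ x₁-var) z-var  ≈⟨ comb-at z-var x₁-var (λ k k≢x₁ → *-≡0 (f k) (θ-at-z k k≢x₁)) ⟩
      0P                                ∎)

    f-z≋0 : f z-var ≋ 0P
    f-z≋0 = begin
      f z-var                           ≈⟨ P.*-identityʳ (f z-var) ⟨
      f z-var *P 1P                     ≈⟨ P.*-congˡ {f z-var} (≡⇒≋ θ₀-at-x₁) ⟨
      f z-var *P θ (toℕ z-var) x₁-var   ≈⟨ comb-at x₁-var z-var others ⟩
      0P                                ∎
      where
      others : ∀ k → k ≢ z-var → f k *P θ (toℕ k) x₁-var ≋ 0P
      others k k≢z with var-cases k
      ... | inj₁ k≡z           = ⊥-elim (k≢z k≡z)
      ... | inj₂ (inj₁ ≡.refl) = ≋0-* (θ (toℕ x₁-var) x₁-var) f-x₁≋0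
      ... | inj₂ (inj₂ 2≤k)    = *-≡0 (f k) (θ-x₁ (toℕ k) 2≤k)

    -- θ_k' vanishes at x_k for k' < k, and f vanishes above k: only f k θ_k survives at x_k.
    f-xₖ≋0 : ∀ k → 2 ≤ toℕ k → (∀ k' → toℕ k < toℕ k' → f k' ≋ 0P) → f k ≋ 0P
    f-xₖ≋0 k 2≤k f-above≋0 = ΠF-cancelˡ (factors (toℕ k) 2≤k (toℕ≤ℓ k)) (f k) (begin
      ΠF (factors (toℕ k) 2≤k (toℕ≤ℓ k)) *P f k   ≈⟨ P.*-congʳ {f k} (ΠF-factors (toℕ k) 2≤k (toℕ≤ℓ k)) ⟩
      θ-entry (toℕ k) (toℕ k) *P f k              ≈⟨ P.*-comm _ (f k) ⟩
      f k *P θ-entry (toℕ k) (toℕ k)              ≈⟨ P.*-congˡ {f k} (≡⇒≋ (θ-inside (toℕ k) k 2≤k 2≤k ℕ.≤-refl)) ⟨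
      f k *P θ (toℕ k) k                          ≈⟨ comb-at k k others ⟩
      0P                                          ∎)
      where
      others : ∀ k' → k' ≢ k → f k' *P θ (toℕ k') k ≋ 0P
      others k' k'≢k with var-cases k'
      ... | inj₁ ≡.refl        = ≋0-* (θ (toℕ z-var) k) f-z≋0
      ... | inj₂ (inj₁ ≡.refl) = ≋0-* (θ (toℕ x₁-var) k) f-x₁≋0
      ... | inj₂ (inj₂ 2≤k') with ℕ.<-cmp (toℕ k') (toℕ k)
      ...   | tri< k'<k _ _ = *-≡0 (f k') (θ-outside (toℕ k') k 2≤k' (inj₂ k'<k))
      ...   | tri≈ _ k'≡k _ = ⊥-elim (k'≢k (Fin.toℕ-injective k'≡k))
      ...   | tri> _ _ k<k' = ≋0-* (θ (toℕ k') k) (f-above≋0 k' k<k')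

    coefficients-vanish : ∀ k → f k ≋ 0P
    coefficients-vanish k = vanish-within ℓ k (ℕ.m∸n≤m ℓ (toℕ k))
      where
      vanish-within : ∀ n k → ℓ ℕ.∸ toℕ k ≤ n → f k ≋ 0P
      vanish-within n k ℓ-k≤n with var-cases k
      ... | inj₁ ≡.refl        = f-z≋0
      ... | inj₂ (inj₁ ≡.refl) = f-x₁≋0
      ... | inj₂ (inj₂ 2≤k)    = f-xₖ≋0 k 2≤k (above n ℓ-k≤n)
        where
        above : ∀ n → ℓ ℕ.∸ toℕ k ≤ n → ∀ k' → toℕ k < toℕ k' → f k' ≋ 0P
        above zero    ℓ-k≤0 k' k<k' =
          ⊥-elim (ℕ.<⇒≱ k<k' (ℕ.≤-trans (toℕ≤ℓ k') (ℕ.m∸n≡0⇒m≤n (ℕ.n≤0⇒n≡0 ℓ-k≤0))))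
        above (suc n) ℓ-k≤1+n k' k<k' =
          vanish-within n k' (ℕ.≤-pred (ℕ.≤-trans (ℕ.∸-monoʳ-< k<k' (toℕ≤ℓ k')) ℓ-k≤1+n))

module Generation {c r} (F : Field c r) (ℓ : ℕ) (N : ℕ → List (Field.Carrier F)) (2≤ℓ : 2 ≤ ℓ) where
  open Field F
  open Arr F ℓ N
  open PolynomialRing F ℓ N
  open LinearFactors F ℓ N
  open Derivations F ℓ N
  open Hyperplanes F ℓ N 2≤ℓ
  open Factorisation F ℓ N 2≤ℓ
  open Membership F ℓ N 2≤ℓ
  open Ranges
  open FormalDifferenceSolver polynomialRing using (solve; con; _:+_; _:*_; _:-_; :-_; _:=_)
  open ≋-Reasoning

  Generated : Der → Set (c ⊔ r)
  Generated η = ∃ λ f → ∀ i → η i ≋ comb f i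

  Generated-0 : ∀ η → (∀ i → η i ≋ 0P) → Generated η
  Generated-0 η η≋0 = (λ _ → 0P) , λ i → P.trans (η≋0 i) (P.sym (comb-0 i))

  Generated-step : ∀ η j g → Generated (λ i → η i -P g *P θ (toℕ j) i) → Generated η
  Generated-step η j g (f , η-gθ≋f) = (λ k → f k +P single j g k) , λ i → begin
    η i                                              ≈⟨ solve 2 (λ a b → a := (a :- b) :+ b) P.refl (η i) (g *P θ (toℕ j) i) ⟩
    (η i -P g *P θ (toℕ j) i) +P g *P θ (toℕ j) i    ≈⟨ P.+-cong (η-gθ≋f i) (P.sym (comb-single j g i)) ⟩
    comb f i +P comb (single j g) i                  ≈⟨ comb-+ f (single j g) i ⟨
    comb (λ k → f k +P single j g k) i               ∎

  VanishesAbove : ℕ → Der → Set r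
  VanishesAbove k ζ = ζ z-var ≋ 0P × ζ x₁-var ≋ 0P × (∀ j → k < toℕ j → ζ j ≋ 0P)

  VanishesAbove-≤1 : ∀ {k ζ} → k ≤ 1 → VanishesAbove k ζ → ∀ j → ζ j ≋ 0P
  VanishesAbove-≤1 k≤1 (ζz≋0 , ζx₁≋0 , above≋0) j with var-cases j
  ... | inj₁ ≡.refl        = ζz≋0
  ... | inj₂ (inj₁ ≡.refl) = ζx₁≋0
  ... | inj₂ (inj₂ 2≤j)    = above≋0 j (ℕ.<-≤-trans (s≤s k≤1) 2≤j)

  -- At x_k the hyperplanes x₁ - x_k - a z and x_k - x_t (t > k) only see ζ(x_k),
  -- so each linear factor of θ-entry k k divides it.
  θ-entry-∣-top : FiniteSets F ℓ N → ∀ k 2≤k k≤ℓ ζ → ζ ∈D′ 𝓘N → VanishesAbove k ζ → θ-entry k k ∣ ζ (index k k≤ℓ)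
  θ-entry-∣-top finite k 2≤k k≤ℓ ζ ζ∈D (ζz≋0 , ζx₁≋0 , above≋0) =
    ∣-respˡ (ΠF-∣ (factors k 2≤k k≤ℓ) (factors-coprime finite k 2≤k k≤ℓ) h (All.++⁺ A-∣ B-∣)) (ΠF-factors k 2≤k k≤ℓ)
    where
    h : Poly
    h = ζ (index k k≤ℓ)
    A-∣ : All (λ A → toPoly A ∣ h) (map (A-linear k 2≤k) (N k))
    A-∣ = All.map⁺ (All.tabulate λ {a} a∈ → ∣-respˡ
      (∣-respʳ (∣-neg (All.lookup ζ∈D (hypA∈𝓘N 2≤k k≤ℓ a∈))) (begin
        -P apply ζ (hypA k a)                            ≈⟨ P.-‿cong (apply-hypA ζ k a k≤ℓ) ⟩
        -P (ζ x₁-var -P h -P constP a *P ζ z-var)         ≈⟨ P.-‿cong (P.+-cong (P.+-congʳ { -P h} ζx₁≋0) (P.-‿cong (P.*-congˡ {constP a} ζz≋0))) ⟩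
        -P (0P -P h -P constP a *P 0P)                   ≈⟨ solve 2 (λ h c → :- (con (0 , 0) :- h :- c :* con (0 , 0)) := h) P.refl h (constP a) ⟩
        h                                                ∎))
      (P.trans (L-hypA k a k≤ℓ) (P.sym (A-linear-toPoly k 2≤k a))))
    B-∣ : All (λ B → toPoly B ∣ h) (map (B-linear k k≤ℓ) [ suc k ⋯ ℓ ])
    B-∣ = All.map⁺ (All.tabulate λ {t} t∈ → let (k<t , t≤ℓ) = ∈-⋯⁻ t∈ in ∣-respˡ
      (∣-respʳ (All.lookup ζ∈D (hypB∈𝓘N 2≤k k<t t≤ℓ)) (begin
        apply ζ (hypB k t)                  ≈⟨ apply-hypB ζ k t k≤ℓ t≤ℓ ⟩
        h -P ζ (index t t≤ℓ)                ≈⟨ P.+-congˡ {h} (P.-‿cong (above≋0 (index t t≤ℓ) (≡.subst (k <_) (≡.sym (toℕ-index t t≤ℓ)) k<t))) ⟩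
        h -P 0P                             ≈⟨ solve 1 (λ h → h :- con (0 , 0) := h) P.refl h ⟩
        h                                   ∎))
      (P.trans (L-hypB k t k≤ℓ t≤ℓ) (P.sym (B-linear-toPoly k k≤ℓ t (λ t≡k → ℕ.<⇒≢ k<t (≡.sym t≡k))))))

  VanishesAbove-peel : ∀ k 2≤k k≤ℓ ζ g → VanishesAbove k ζ → ζ (index k k≤ℓ) ≋ g *P θ k (index k k≤ℓ) →
    VanishesAbove (ℕ.pred k) (λ i → ζ i -P g *P θ k i)
  VanishesAbove-peel k 2≤k k≤ℓ ζ g (ζz≋0 , ζx₁≋0 , above≋0) top =
    minus-0 ζz≋0 (θ-z k 2≤k) , minus-0 ζx₁≋0 (θ-x₁ k 2≤k) , above
    where
    minus-0 : ∀ {i} → ζ i ≋ 0P → θ k i ≡ 0P → ζ i -P g *P θ k i ≋ 0P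
    minus-0 ζi≋0 θi≡0 = P.trans (P.+-cong ζi≋0 (P.-‿cong (*-≡0 g θi≡0))) P.refl
    above : ∀ j → ℕ.pred k < toℕ j → ζ j -P g *P θ k j ≋ 0P
    above j k-1<j with toℕ j ℕ.≟ k
    ... | no  j≢k = let k<j = ℕ.≤∧≢⇒< k≤j (j≢k ∘ ≡.sym) in
                    minus-0 (above≋0 j k<j) (θ-outside k j 2≤k (inj₂ k<j))
      where k≤j = ≡.subst (_≤ toℕ j) (ℕ.suc-pred k ⦃ ℕ.>-nonZero (ℕ.<-≤-trans (s≤s z≤n) 2≤k) ⦄) k-1<j
    ... | yes j≡k = ≡.subst (λ j → ζ j -P g *P θ k j ≋ 0P) (Fin.toℕ-injective (≡.trans (toℕ-index k k≤ℓ) (≡.sym j≡k)))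
                      (P.trans (P.+-congʳ { -P (g *P θ k (index k k≤ℓ))} top) (P.-‿inverseʳ (g *P θ k (index k k≤ℓ))))

  VanishesAbove⇒Generated : FiniteSets F ℓ N → Nested F ℓ N → ∀ k → k ≤ ℓ → ∀ ζ → ζ ∈D′ 𝓘N → VanishesAbove k ζ → Generated ζ
  VanishesAbove⇒Generated finite nested zero       _   ζ _ v = Generated-0 ζ (VanishesAbove-≤1 z≤n v)
  VanishesAbove⇒Generated finite nested (suc zero) _   ζ _ v = Generated-0 ζ (VanishesAbove-≤1 (s≤s z≤n) v)
  VanishesAbove⇒Generated finite nested (suc (suc m)) k≤ℓ ζ ζ∈D v = Generated-step ζ (index k k≤ℓ) g
    (≡.subst (λ n → Generated (λ i → ζ i -P g *P θ n i)) (≡.sym (toℕ-index k k≤ℓ))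
      (VanishesAbove⇒Generated finite nested (suc m) (ℕ.<⇒≤ k≤ℓ) _
        (∈D′-−-* ζ (θ k) g 𝓘N ζ∈D (θₖ∈D nested k 2≤k k≤ℓ))
        (VanishesAbove-peel k 2≤k k≤ℓ ζ g v (P.trans top (P.trans (P.*-comm (θ-entry k k) g)
          (P.*-congˡ {g} (≡⇒≋ (≡.sym (θ-inside-index k k k≤ℓ 2≤k 2≤k ℕ.≤-refl)))))))))
    where
    k : ℕ
    k = suc (suc m)
    2≤k : 2 ≤ k
    2≤k = s≤s (s≤s z≤n)
    open _∣_ (θ-entry-∣-top finite k 2≤k k≤ℓ ζ ζ∈D v) renaming (cofactor to g; factorisation to top)

  generation : FiniteSets F ℓ N → Nested F ℓ N → ∀ η → η ∈D′ 𝓘N → Generated η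
  generation finite nested η η∈D =
    Generated-step η z-var f₀ (Generated-step η₀ x₁-var g₁ (VanishesAbove⇒Generated finite nested ℓ ℕ.≤-refl ζ ζ∈D
      (ζz≋0 , ζx₁≋0 , λ j ℓ<j → ⊥-elim (ℕ.<⇒≱ ℓ<j (toℕ≤ℓ j)))))
    where
    open _∣_ (All.head η∈D) renaming (cofactor to g₁; factorisation to ηz-factorisation)
    θ₁ : Der
    θ₁ = θ (toℕ x₁-var)
    f₀ : Poly
    f₀ = η x₁-var -P g₁ *P θ₁ x₁-var
    η₀ ζ : Der
    η₀ i = η i -P f₀ *P θ 0 i
    ζ  i = η₀ i -P g₁ *P θ₁ i
    ζ∈D : ζ ∈D′ 𝓘N
    ζ∈D = ∈D′-−-* η₀ θ₁ g₁ 𝓘N (∈D′-−-* η (θ 0) f₀ 𝓘N η∈D θ₀∈D) (θ∈D nested x₁-var)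
    ζz≋0 : ζ z-var ≋ 0P
    ζz≋0 = begin
      η z-var -P f₀ *P 0P -P g₁ *P θ₁ z-var   ≈⟨ P.+-cong (P.+-congʳ { -P (f₀ *P 0P)} ηz≋zg₁) (P.-‿cong (P.*-congˡ {g₁} (≡⇒≋ θ₁-at-z))) ⟩
      z *P g₁ -P f₀ *P 0P -P g₁ *P z         ≈⟨ solve 3 (λ z g f → z :* g :- f :* con (0 , 0) :- g :* z := con (0 , 0)) P.refl z g₁ f₀ ⟩
      0P                                     ∎
      where
      ηz≋zg₁ : η z-var ≋ z *P g₁
      ηz≋zg₁ = P.trans (P.sym (apply-e η z-var)) (P.trans ηz-factorisation (P.*-congʳ {g₁} L-e0))
    ζx₁≋0 : ζ x₁-var ≋ 0P
    ζx₁≋0 = begin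
      η x₁-var -P f₀ *P θ 0 x₁-var -P g₁ *P θ₁ x₁-var   ≈⟨ P.+-congʳ { -P (g₁ *P θ₁ x₁-var)} (P.+-congˡ {η x₁-var} (P.-‿cong (P.*-congˡ {f₀} (≡⇒≋ θ₀-at-x₁)))) ⟩
      η x₁-var -P f₀ *P 1P -P g₁ *P θ₁ x₁-var          ≈⟨ solve 2 (λ h t → h :- (h :- t) :* con (1 , 0) :- t := con (0 , 0)) P.refl (η x₁-var) (g₁ *P θ₁ x₁-var) ⟩
      0P                                               ∎

module Degrees {c r} (F : Field c r) (ℓ : ℕ) (N : ℕ → List (Field.Carrier F)) (2≤ℓ : 2 ≤ ℓ) where
  open Field F
  open Arr F ℓ N
  open PolynomialRing F ℓ N
  open LinearFactors F ℓ N
  open Derivations F ℓ N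
  open Hyperplanes F ℓ N 2≤ℓ
  open Factorisation F ℓ N 2≤ℓ
  open Ranges
  open import Algebra.Properties.CommutativeSemigroup ℕ.+-commutativeSemigroup using () renaming (interchange to +-interchange)

  degree-⊕ : ∀ {n} (e f : Vec ℕ n) → Vec.sum (e ⊕ f) ≡ Vec.sum e ℕ.+ Vec.sum f
  degree-⊕ Vec.[] Vec.[] = ≡.refl
  degree-⊕ (a Vec.∷ e) (b Vec.∷ f) = ≡.trans (≡.cong (a ℕ.+ b ℕ.+_) (degree-⊕ e f)) (+-interchange a b (Vec.sum e) (Vec.sum f))

  degree-replicate-0 : ∀ n → Vec.sum (replicate n 0) ≡ 0
  degree-replicate-0 zero    = ≡.refl
  degree-replicate-0 (suc n) = degree-replicate-0 n

  degree-δ : ∀ n i → i < n → Vec.sum (tabulate {n = n} (λ j → if toℕ j ≡ᵇ i then 1 else 0)) ≡ 1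
  degree-δ (suc n) zero    _         = ≡.cong suc (degree-tabulate-0 n)
    where
    degree-tabulate-0 : ∀ n → Vec.sum (tabulate {n = n} (λ _ → 0)) ≡ 0
    degree-tabulate-0 zero    = ≡.refl
    degree-tabulate-0 (suc n) = degree-tabulate-0 n
  degree-δ (suc n) (suc i) (s≤s i<n) = degree-δ n i i<n

  Homogeneous : ℕ → Poly → Set c
  Homogeneous d p = All (λ t → Vec.sum (proj₂ t) ≡ d) p

  Homogeneous⇒HomPoly : ∀ d p → Homogeneous d p → HomPoly d p
  Homogeneous⇒HomPoly d p hom m coeff≉0 with Vec.sum m ℕ.≟ d
  ... | yes deg≡d = deg≡d
  ... | no  deg≢d = ⊥-elim (coeff≉0 (absent p (All.map (λ {t} deg-t≡d t≡m → deg≢d (≡.trans (≡.cong Vec.sum (≡.sym t≡m)) deg-t≡d)) hom)))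
    where
    absent : ∀ p → All (λ t → proj₂ t ≢ m) p → coeff p m ≈ 0#
    absent []            []            = refl
    absent ((a , e) ∷ p) (e≢m ∷ e≢ms) =
      trans (coeff-cons (a , e) p m) (trans (+-cong (coeffₜ-other a e m e≢m) (absent p e≢ms)) (+-identityˡ 0#))

  Homogeneous-*P : ∀ a b p q → Homogeneous a p → Homogeneous b q → Homogeneous (a ℕ.+ b) (p *P q)
  Homogeneous-*P a b []            q _          _  = []
  Homogeneous-*P a b ((x , e) ∷ p) q (hₑ ∷ hp) hq =
    All.++⁺ (All.map⁺ (All.map (λ {t} hₜ → ≡.trans (degree-⊕ e (proj₂ t)) (≡.cong₂ ℕ._+_ hₑ hₜ)) hq)) (Homogeneous-*P a b p q hp hq)

  Homogeneous-neg : ∀ {d} p → Homogeneous d p → Homogeneous d (-P p)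
  Homogeneous-neg p = All.map⁺

  Homogeneous-X : ∀ i → i ≤ ℓ → Homogeneous 1 (X i)
  Homogeneous-X i i≤ℓ = degree-δ (suc ℓ) i (s≤s i≤ℓ) ∷ []

  Homogeneous-constP : ∀ a → Homogeneous 0 (constP a)
  Homogeneous-constP a = degree-replicate-0 (suc ℓ) ∷ []

  Homogeneous-ΠL : ∀ ps → All (Homogeneous 1) ps → Homogeneous (List.length ps) (ΠL ps)
  Homogeneous-ΠL []       []        = Homogeneous-constP 1#
  Homogeneous-ΠL (p ∷ ps) (hp ∷ hps) = Homogeneous-*P 1 (List.length ps) p (ΠL ps) hp (Homogeneous-ΠL ps hps)

  Homogeneous-A-factor : ∀ s a → s ≤ ℓ → Homogeneous 1 (A-factor s a)
  Homogeneous-A-factor s a s≤ℓ = All.++⁺ (All.++⁺ (Homogeneous-X 1 1≤ℓ) (Homogeneous-neg (x s) (Homogeneous-X s s≤ℓ)))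
    (Homogeneous-neg (constP a *P z) (Homogeneous-*P 0 1 (constP a) z (Homogeneous-constP a) (Homogeneous-X 0 z≤n)))

  Homogeneous-B-factor : ∀ s t → s ≤ ℓ → t ≤ ℓ → Homogeneous 1 (B-factor s t)
  Homogeneous-B-factor s t s≤ℓ t≤ℓ = All.++⁺ (Homogeneous-X s s≤ℓ) (Homogeneous-neg (x t) (Homogeneous-X t t≤ℓ))

  Homogeneous-θ-entry : ∀ k s → s ≤ ℓ → Homogeneous (List.length (N k) ℕ.+ (ℓ ℕ.∸ k)) (θ-entry k s)
  Homogeneous-θ-entry k s s≤ℓ = ≡.subst (λ d → Homogeneous d (θ-entry k s)) degree-eq
    (Homogeneous-*P _ _ _ _
      (Homogeneous-ΠL (map (A-factor s) (N k)) (All.map⁺ (All.tabulate λ {a} _ → Homogeneous-A-factor s a s≤ℓ)))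
      (Homogeneous-ΠL (map (B-factor s) [ suc k ⋯ ℓ ]) (All.map⁺ (All.tabulate λ {t} t∈ → Homogeneous-B-factor s t s≤ℓ (proj₂ (∈-⋯⁻ t∈))))))
    where
    degree-eq : List.length (map (A-factor s) (N k)) ℕ.+ List.length (map (B-factor s) [ suc k ⋯ ℓ ])
              ≡ List.length (N k) ℕ.+ (ℓ ℕ.∸ k)
    degree-eq = ≡.cong₂ ℕ._+_ (List.length-map (A-factor s) (N k))
                              (≡.trans (List.length-map (B-factor s) [ suc k ⋯ ℓ ]) (length-⋯ (suc k) ℓ))

  Homogeneous-if : ∀ {d} (b : Bool) {p q} → Homogeneous d p → Homogeneous d q → Homogeneous d (if b then p else q)
  Homogeneous-if true  hp hq = hp
  Homogeneous-if false hp hq = hq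

  1P≉0P : ¬ (1P ≋ 0P)
  1P≉0P 1≋0 = 1≉0 (trans (sym (coeffₜ-self 1# (replicate _ 0))) (get 1≋0 (replicate _ 0)))

  θ-homogeneous : ∀ (j : Var) → HomDer (expo (toℕ j)) (θ (toℕ j))
  θ-homogeneous j with toℕ j | toℕ≤ℓ j
  ... | zero | _ =
    (λ i → Homogeneous⇒HomPoly 0 (θ 0 i) (Homogeneous-if (toℕ i ≡ᵇ 0) [] (Homogeneous-constP 1#))) ,
    (λ θ₀≈0 → 1P≉0P (P.trans (≡⇒≋ (≡.sym θ₀-at-x₁)) (mk (θ₀≈0 x₁-var))))
  ... | suc zero | _ =
    (λ i → Homogeneous⇒HomPoly 1 (X (toℕ i)) (Homogeneous-X (toℕ i) (toℕ≤ℓ i))) ,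
    (λ θ₁≈0 → 1≉0 (trans (sym (coeffₜ-self 1# (δ 0))) (θ₁≈0 z-var (δ 0))))
  ... | suc (suc m) | k≤ℓ =
    (λ i → Homogeneous⇒HomPoly _ (θ k i) (≡.subst (λ d → Homogeneous d (θ k i)) (≡.sym (ℕ.+-∸-assoc (List.length (N k)) k≤ℓ))
      (Homogeneous-if ((2 ≤ᵇ toℕ i) ∧ (toℕ i ≤ᵇ k)) (Homogeneous-θ-entry k (toℕ i) (toℕ≤ℓ i)) []))) ,
    (λ θₖ≈0 → 1P≉0P (ΠF-cancelˡ (factors k 2≤k k≤ℓ) 1P (begin
      ΠF (factors k 2≤k k≤ℓ) *P 1P   ≈⟨ P.*-congʳ {1P} (ΠF-factors k 2≤k k≤ℓ) ⟩
      θ-entry k k *P 1P               ≈⟨ P.*-congʳ {1P} (≡⇒≋ (θ-inside-index k k k≤ℓ 2≤k 2≤k ℕ.≤-refl)) ⟨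
      θ k (index k k≤ℓ) *P 1P         ≈⟨ P.*-congʳ {1P} (mk {θ k (index k k≤ℓ)} {0P} (θₖ≈0 (index k k≤ℓ))) ⟩
      0P *P 1P                        ≈⟨ P.zeroˡ 1P ⟩
      0P                              ∎)))
    where
    k : ℕ
    k = suc (suc m)
    2≤k : 2 ≤ k
    2≤k = s≤s (s≤s z≤n)
    open ≋-Reasoning

theorem1p4 : ∀ {c r} (F : Field c r) → CharZero F →
    (ℓ : ℕ) → 2 ≤ ℓ →
    (N : ℕ → List (Field.Carrier F)) →
    FiniteSets F ℓ N → Nested F ℓ N →
    Arr.Conclusion F ℓ N
theorem1p4 F _ ℓ 2≤ℓ N finite nested = (θ-in-D , spanning , independent) , θ-homogeneous
  where
  open Arr F ℓ N
  open PolynomialRing F ℓ N using (mk; get)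
  open Derivations F ℓ N using (∈D′⇒∈D; ∈D⇒∈D′)
  open Membership F ℓ N 2≤ℓ using (θ∈D)
  open Independence F ℓ N 2≤ℓ using (coefficients-vanish)
  open Generation F ℓ N 2≤ℓ using (generation)
  open Degrees F ℓ N 2≤ℓ using (θ-homogeneous)

  θ-in-D : ∀ (k : Fin (suc ℓ)) → θ (toℕ k) ∈D 𝓘N
  θ-in-D k = ∈D′⇒∈D (θ (toℕ k)) 𝓘N (θ∈D nested k)

  spanning : ∀ η → η ∈D 𝓘N → ∃ λ f → ∀ i → η i ≈P comb f i
  spanning η η∈D = let (f , η≋comb) = generation finite nested η (∈D⇒∈D′ η 𝓘N η∈D) in f , λ i → get (η≋comb i)

  independent : ∀ f → (∀ i → comb f i ≈P 0P) → ∀ k → f k ≈P 0P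
  independent f comb≈0 k = get (coefficients-vanish f (λ i → mk (comb≈0 i)) k)
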